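{- Let $M = \prod_{i\to\mathcal{U}} M_i$ be an ultraproduct of finite structures with $M\models T$ (described below), viewed in the language $L_C$. Let $k\in\omega$ and let $\phi(x,y_0,\ldots,y_{m-1})$ (with $m \geq 1$) be a $k$-basic formula. Then $\phi$ has quantifier-free definable polynomial cardinality in the formula $z E y_0$ over $\mathbb{Z}$.
   Context: $E$ is a binary relation and $f,g$ unary functions; for $s = s_1\cdots s_n\in\{f,g\}^n$, $s(x)$ denotes $s_1(s_2(\cdots s_n(x)\cdots))$. $T_0$: (a) $E$ is an equivalence relation; (b) $xEy \to f(x)Eg(y)$; (c) there is a single class $C_{fin} = \{x: f(x)=x\}=\{x:g(x)=x\}$; (d) there is a single class $C_{init} = \{x:\text{no } z \text{ has } f(z)=x\} = \{x:\text{no } z\text{ has } g(z)=x\}$; (e) $x,y\notin C_{fin}$ and $f(x)Ef(y)$ imply $xEy$; (f) for each class $C\ne C_{init}$ and $(x,y)\in C^2$ there is a unique $z$ (unique $z\notin C_{fin}$ if $C=C_{fin}$) with $f(z)=x$, $g(z)=y$. $T = T_0$ plus (g) for $k\ge1$, $x\notin C_{fin}\to\neg(f^k(x)Ex)$; (h) infinitely many classes; (i) all classes infinite. $L_C$ expands $\{E,f,g\}$ by unary predicates $C_{init+k}$ (interpreted as $f^k(C_{init})$) and $C_{fin-k}$ ($C_{fin-0}=C_{fin}$, $C_{fin-k} = f^{ -k}(C_{fin})\setminus f^{ -(k-1)}(C_{fin})$ for $k\ge1$). A $k$-basic formula is one of the form $\bigwedge_{i=0}^{m-1} s_i(x) =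 y_i$ with each $s_i \in\{f,g\}^k$. For definable $X=\psi(M,\bar b)$, $|X|\in\mathbb{R}^\star=\prod_{i\to\mathcal{U}}\mathbb{R}$ is the class of $(|\psi(M_i,\bar b_i)|)_i$. $\varphi(\bar x,\bar y)$ has quantifier-free definable polynomial cardinality in $\theta(\bar z,\bar y)$ over $\mathbb{Z}$ if there are nonzero polynomials $F_1,\ldots,F_r\in\mathbb{Z}[X]$ and quantifier-free $\pi_1(\bar y),\ldots,\pi_r(\bar y)$ with: $M\models\pi_i(\bar b)\Rightarrow|\varphi(M,\bar b)| = F_i(|\theta(M,\bar b)|)$, and $M\models\bigwedge_i\neg\pi_i(\bar b)\Rightarrow\varphi(M,\bar b)=\emptyset$. -}

module Defs where

open import Data.Nat using (ℕ; zero; suc)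
import Data.Nat as ℕ
open import Data.Fin using (Fin; zero; suc; _≟_)
open import Data.Bool using (Bool; true; false; _∧_; if_then_else_)
open import Data.Integer using (ℤ; +_)
import Data.Integer as ℤ
open import Data.List using (List; []; _∷_)
open import Data.List.Relation.Unary.Any using (Any)
open import Data.Vec using (Vec; []; _∷_)
open import Data.Product using (Σ; _×_; _,_)
open import Data.Sum using (_⊎_)
open import Data.Empty using (⊥)
open import Data.Unit using (⊤)
open import Relation.Nullary using (¬_)
open import Relation.Nullary.Decidable using (⌊_⌋)
open import Relation.Binary.PropositionalEquality using (_≡_; _≢_)

record Ultrafilter (I : Set) : Set₁ where
  field
    U        : (I → Set) → Set
    U-full   : U (λ _ → ⊤)
    U-proper : ¬ U (λ _ → ⊥)
    U-mono   : ∀ {A B : I → Set} → (∀ i → A i → B i) → U A → U B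
    U-∩      : ∀ {A B : I → Set} → U A → U B → U (λ i → A i × B i)
    U-ultra  : ∀ (A : I → Set) → U A ⊎ U (λ i → ¬ A i)

-- Finite {E,f,g}-structures; carrier Fin (suc size) (structures are nonempty).

record FinStr : Set where
  field
    size : ℕ
    E    : Fin (suc size) → Fin (suc size) → Bool
    f    : Fin (suc size) → Fin (suc size)
    g    : Fin (suc size) → Fin (suc size)

data FG : Set where
  𝑓 𝑔 : FG

applyWord : {A : Set} → (A → A) → (A → A) → {k : ℕ} → Vec FG k → A → A
applyWord F G []       x = x
applyWord F G (𝑓 ∷ w) x = F (applyWord F G w x)
applyWord F G (𝑔 ∷ w) x = G (applyWord F G w x)

iter : {A : Set} → (A → A) → ℕ → A → A
iter F zero    x = x
iter F (suc k) x = F (iter F k x)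

countFin : (n : ℕ) → (Fin n → Bool) → ℕ
countFin zero    p = 0
countFin (suc n) p = (if p zero then 1 else 0) ℕ.+ countFin n (λ i → p (suc i))

allFinB : (n : ℕ) → (Fin n → Bool) → Bool
allFinB zero    p = true
allFinB (suc n) p = p zero ∧ allFinB n (λ i → p (suc i))

-- |φ(M_i, b_i)| for the k-basic formula φ(x,ȳ) = ⋀_j s_j(x) = y_j
cardBasic : (M : FinStr) {k m : ℕ} → (Fin m → Vec FG k)
          → (Fin m → Fin (suc (FinStr.size M))) → ℕ
cardBasic M {k} {m} s b =
  countFin (suc (FinStr.size M))
    (λ x → allFinB m (λ j → ⌊ applyWord (FinStr.f M) (FinStr.g M) (s j) x ≟ b j ⌋))

cardClass : (M : FinStr) → Fin (suc (FinStr.size M)) → ℕ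
cardClass M b = countFin (suc (FinStr.size M)) (λ z → FinStr.E M z b)

-- Polynomials in ℤ[X] as coefficient lists (constant term first).

Poly : Set
Poly = List ℤ

evalPoly : Poly → ℤ → ℤ
evalPoly []       x = + 0
evalPoly (c ∷ cs) x = c ℤ.+ x ℤ.* evalPoly cs x

NonZeroPoly : Poly → Set
NonZeroPoly F = Any (λ c → c ≢ + 0) F

data Term (m : ℕ) : Set where
  var : Fin m → Term m
  fT  : Term m → Term m
  gT  : Term m → Term m

data QF (m : ℕ) : Set where
  ⊤F ⊥F   : QF m
  _≐_     : Term m → Term m → QF m
  Eat     : Term m → Term m → QF m
  Cinit+  : ℕ → Term m → QF m
  Cfin-   : ℕ → Term m → QF m
  ¬F_     : QF m → QF m
  _∧F_    : QF m → QF m → QF m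
  _∨F_    : QF m → QF m → QF m

-- The ultraproduct M = ∏_{i→𝒰} M_i (as a setoid-structure).

module Ultraproduct {I : Set} (𝒰 : Ultrafilter I) (Ms : I → FinStr) where
  open Ultrafilter 𝒰

  Car : Set
  Car = (i : I) → Fin (suc (FinStr.size (Ms i)))

  _~_ : Car → Car → Set
  x ~ y = U (λ i → x i ≡ y i)

  Eₘ : Car → Car → Set
  Eₘ x y = U (λ i → FinStr.E (Ms i) (x i) (y i) ≡ true)

  fₘ gₘ : Car → Car
  fₘ x i = FinStr.f (Ms i) (x i)
  gₘ x i = FinStr.g (Ms i) (x i)

  _⇔_ : Set → Set → Set
  A ⇔ B = (A → B) × (B → A)

  FixF FixG : Car → Set
  FixF x = fₘ x ~ x
  FixG x = gₘ x ~ x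

  NoPreF NoPreG : Car → Set
  NoPreF x = ¬ Σ Car (λ z → fₘ z ~ x)
  NoPreG x = ¬ Σ Car (λ z → gₘ z ~ x)

  ∃!Pre : (Car → Set) → Car → Car → Set
  ∃!Pre P x y = Σ Car (λ z → P z × fₘ z ~ x × gₘ z ~ y
                   × (∀ z' → P z' → fₘ z' ~ x → gₘ z' ~ y → z' ~ z))

  record ModelOfT : Set where
    field
      E-refl  : ∀ x → Eₘ x x
      E-sym   : ∀ x y → Eₘ x y → Eₘ y x
      E-trans : ∀ x y z → Eₘ x y → Eₘ y z → Eₘ x z
      ax-b : ∀ x y → Eₘ x y → Eₘ (fₘ x) (gₘ y)
      ax-c : Σ Car (λ c → ∀ x → (FixF x ⇔ Eₘ x c) × (FixG x ⇔ Eₘ x c))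
      ax-d : Σ Car (λ c → ∀ x → (NoPreF x ⇔ Eₘ x c) × (NoPreG x ⇔ Eₘ x c))
      ax-e : ∀ x y → ¬ FixF x → ¬ FixF y → Eₘ (fₘ x) (fₘ y) → Eₘ x y
      ax-f-notfin : ∀ x y → Eₘ x y → ¬ NoPreF x → ¬ FixF x
                    → ∃!Pre (λ _ → ⊤) x y
      ax-f-fin    : ∀ x y → Eₘ x y → ¬ NoPreF x → FixF x
                    → ∃!Pre (λ z → ¬ FixF z) x y
      ax-g : ∀ k x → ¬ FixF x → ¬ Eₘ (iter fₘ (suc k) x) x
      ax-h : ∀ n → Σ (Fin n → Car) (λ v → ∀ i j → i ≢ j → ¬ Eₘ (v i) (v j))
      ax-i : ∀ x n → Σ (Fin n → Car)
               (λ v → (∀ i j → i ≢ j → ¬ (v i ~ v j)) × (∀ i → Eₘ (v i) x))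

  Cinit+ₘ : ℕ → Car → Set
  Cinit+ₘ k t = Σ Car (λ x → NoPreF x × iter fₘ k x ~ t)

  Cfin-ₘ : ℕ → Car → Set
  Cfin-ₘ zero    t = FixF t
  Cfin-ₘ (suc k) t = FixF (iter fₘ (suc k) t) × ¬ FixF (iter fₘ k t)

  evalTerm : {m : ℕ} → (Fin m → Car) → Term m → Car
  evalTerm b (var j) = b j
  evalTerm b (fT t)  = fₘ (evalTerm b t)
  evalTerm b (gT t)  = gₘ (evalTerm b t)

  Sat : {m : ℕ} → (Fin m → Car) → QF m → Set
  Sat b ⊤F          = ⊤
  Sat b ⊥F          = ⊥
  Sat b (t ≐ u)     = evalTerm b t ~ evalTerm b u
  Sat b (Eat t u)   = Eₘ (evalTerm b t) (evalTerm b u)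
  Sat b (Cinit+ k t) = Cinit+ₘ k (evalTerm b t)
  Sat b (Cfin- k t)  = Cfin-ₘ k (evalTerm b t)
  Sat b (¬F φ)      = ¬ Sat b φ
  Sat b (φ ∧F ψ)    = Sat b φ × Sat b ψ
  Sat b (φ ∨F ψ)    = Sat b φ ⊎ Sat b ψ

  -- |φ(M,b̄)| = F(|θ(M,b̄)|) in ℝ* = ∏_{i→𝒰} ℝ, with θ(z,ȳ) = z E y₀
  CardEq : {k m : ℕ} → (Fin (suc m) → Vec FG k) → (Fin (suc m) → Car) → Poly → Set
  CardEq s b F = U (λ i → + cardBasic (Ms i) s (λ j → b j i)
                          ≡ evalPoly F (+ cardClass (Ms i) (b zero i)))

  BasicEmpty : {k m : ℕ} → (Fin m → Vec FG k) → (Fin m → Car) → Set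
  BasicEmpty s b = ¬ Σ Car (λ x → ∀ j → applyWord fₘ gₘ (s j) x ~ b j)

  QFDefPolyCard : {k m : ℕ} → (Fin (suc m) → Vec FG k) → Set
  QFDefPolyCard {k} {m} s =
    Σ ℕ (λ r → Σ (Fin r → Poly) (λ F → Σ (Fin r → QF (suc m)) (λ π →
      (∀ l → NonZeroPoly (F l))
      × (∀ (b : Fin (suc m) → Car) →
           (∀ l → Sat b (π l) → CardEq s b (F l))
           × ((∀ l → ¬ Sat b (π l)) → BasicEmpty s b)))))

-- Rewrite s_t(x) = y_t as a constraint on the word read from its innermost letter. In almost every
-- factor M_i the relevant consequences of T hold, and there every solution x satisfies f^k(x) E y₀.
-- If y₀ ∉ C_fin, all solutions lie in a single class, and for a class outside C_fin the map
-- x ↦ (f x , g x) is a bijection onto the square of the next class; by induction on the word length the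
-- solutions number |y₀/E|^e, where e counts the words of length k carrying no constraint (and the system
-- is consistent). If y₀ ∈ C_fin, a solution reaches C_fin after some j ≤ k steps; the elements with this
-- property form the single class C_fin−j, on which only the first j letters of each word matter, so the
-- count is the sum of |y₀/E|^{e_j} over the levels j that are nonempty and consistent. Nonemptiness and
-- consistency are quantifier-free conditions on ȳ, which gives 1 + 2^{k+1} quantifier-free cases, and
-- Łoś's theorem carries them from the factors to the ultraproduct.

module Submission where

open import Defs
open import Data.Bool using (Bool; true; false; if_then_else_; _∧_)
import Data.Bool.Properties as Bool
open import Data.Empty using (⊥; ⊥-elim)
open import Data.Fin using (Fin; zero; suc; toℕ; fromℕ; inject₁; finToFun; funToFin; _≟_)
open import Data.Fin.Properties
  using (suc-injective; toℕ-injective; any?; toℕ<n; toℕ≤pred[n]; toℕ-fromℕ; toℕ-inject₁; finToFun-funToFin)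
import Data.Integer as ℤ
import Data.Integer.Properties as ℤ
open import Data.List using (List; []; _∷_)
import Data.List as List
open import Data.List.Relation.Unary.All as All using (All; []; _∷_)
import Data.List.Relation.Unary.All.Properties as All
open import Data.List.Relation.Unary.Any using (here; there)
open import Data.Nat using (ℕ; zero; suc; _+_; _*_; _^_; _≤_; s≤s)
open import Data.Nat.Properties
  using (+-*-semiring; *-commutativeSemigroup; +-commutativeSemigroup; +-identityʳ; *-identityˡ; *-identityʳ;
         *-zeroʳ; *-assoc; *-distribˡ-+; ^-distribˡ-+-*; ^-zeroˡ; +-comm; +-suc; <-cmp; m≤n⇒∃[o]m+o≡n;
         m+n≡0⇒m≡0; m+n≡0⇒n≡0; 1+n≢0)
open import Algebra.Properties.CommutativeSemigroup *-commutativeSemigroup using (interchange; x∙yz≈y∙xz)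
open import Algebra.Properties.CommutativeSemigroup +-commutativeSemigroup
  using () renaming (interchange to +-interchange)
open import Algebra.Properties.Semiring.Sum +-*-semiring
  using (sum-syntax; sum-cong-≗; sum-replicate-zero; ∑-comm; *-distribˡ-sum; *-distribʳ-sum)
open import Data.Product using (Σ; _×_; _,_; proj₁; proj₂)
open import Data.Sum using (_⊎_; inj₁; inj₂; fromInj₂)
open import Data.Unit using (⊤; tt)
open import Data.Vec using (Vec; []; _∷_; _∷ʳ_; reverse; truncate)
open import Data.Vec.Properties using (reverse-∷)
open import Function using (_∘_; mk⇔)
open import Relation.Binary using (tri<; tri≈; tri>)
open import Relation.Binary.PropositionalEquality
open import Relation.Nullary using (¬_; Dec; yes; no; ¬?; _×-dec_; _⊎-dec_)
open import Relation.Nullary.Decidable using (⌊_⌋; decidable-stable)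

𝟙 : Bool → ℕ
𝟙 b = if b then 1 else 0

𝟙-yes : ∀ {P : Set} (d : Dec P) → P → 𝟙 ⌊ d ⌋ ≡ 1
𝟙-yes (yes _) _ = refl
𝟙-yes (no ¬p) p = ⊥-elim (¬p p)

𝟙-no : ∀ {P : Set} (d : Dec P) → ¬ P → 𝟙 ⌊ d ⌋ ≡ 0
𝟙-no (yes p) ¬p = ⊥-elim (¬p p)
𝟙-no (no _) _ = refl

𝟙≢0⇒ : ∀ {P : Set} (d : Dec P) → 𝟙 ⌊ d ⌋ ≢ 0 → P
𝟙≢0⇒ (yes p) _ = p
𝟙≢0⇒ (no _) h = ⊥-elim (h refl)

𝟙-∧ : ∀ a c → 𝟙 (a ∧ c) ≡ 𝟙 a * 𝟙 c
𝟙-∧ true  c = sym (+-identityʳ (𝟙 c))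
𝟙-∧ false c = refl

true≢false : true ≢ false
true≢false ()

𝟙≢0⇒true : ∀ {b} → 𝟙 b ≢ 0 → b ≡ true
𝟙≢0⇒true {true}  _ = refl
𝟙≢0⇒true {false} h = ⊥-elim (h refl)

countFin≡∑𝟙 : ∀ n (p : Fin n → Bool) → countFin n p ≡ ∑[ x < n ] 𝟙 (p x)
countFin≡∑𝟙 zero p = refl
countFin≡∑𝟙 (suc n) p = cong (𝟙 (p zero) +_) (countFin≡∑𝟙 n (p ∘ suc))

∑-zero : ∀ {n} (h : Fin n → ℕ) → (∀ x → h x ≡ 0) → ∑[ x < n ] h x ≡ 0
∑-zero {n} h h≡0 = trans (sum-cong-≗ h≡0) (sum-replicate-zero n)

∑-single : ∀ {n} (c : Fin n) (h : Fin n → ℕ) → (∀ x → x ≢ c → h x ≡ 0) → ∑[ x < n ] h x ≡ h c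
∑-single zero h h≡0 =
  trans (cong (h zero +_) (∑-zero (h ∘ suc) (λ x → h≡0 (suc x) λ ())))
        (+-identityʳ (h zero))
∑-single (suc c) h h≡0 =
  cong₂ _+_ (h≡0 zero λ ()) (∑-single c (h ∘ suc) (λ x x≢c → h≡0 (suc x) (x≢c ∘ suc-injective)))

∑-restrict : ∀ {n} (p : Fin n → Bool) (h : Fin n → ℕ) → (∀ x → h x ≢ 0 → p x ≡ true) →
  ∑[ x < n ] h x ≡ ∑[ x < n ] (𝟙 (p x) * h x)
∑-restrict p h inside = sum-cong-≗ pointwise
  where
    pointwise : ∀ x → h x ≡ 𝟙 (p x) * h x
    pointwise x with h x in hx
    ... | zero  = sym (*-zeroʳ (𝟙 (p x)))
    ... | suc v = sym (trans (cong (λ q → 𝟙 q * suc v) (inside x λ h≡0 → 1+n≢0 (trans (sym hx) h≡0)))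
                             (+-identityʳ (suc v)))

∑≡0⇒≡0 : ∀ {n} (h : Fin n → ℕ) → ∑[ x < n ] h x ≡ 0 → ∀ x → h x ≡ 0
∑≡0⇒≡0 h ∑≡0 zero    = m+n≡0⇒m≡0 (h zero) ∑≡0
∑≡0⇒≡0 h ∑≡0 (suc x) = ∑≡0⇒≡0 (h ∘ suc) (m+n≡0⇒n≡0 (h zero) ∑≡0) x

δ : ∀ {n} → Fin n → Fin n → ℕ
δ x y = 𝟙 ⌊ x ≟ y ⌋

∑-δ : ∀ {n} (c : Fin n) (h : Fin n → ℕ) → ∑[ u < n ] (δ c u * h u) ≡ h c
∑-δ c h = trans (∑-single c (λ u → δ c u * h u) off)
                (trans (cong (_* h c) (𝟙-yes (c ≟ c) refl)) (*-identityˡ (h c)))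
  where off : ∀ u → u ≢ c → δ c u * h u ≡ 0
        off u u≢c = cong (_* h u) (𝟙-no (c ≟ u) (u≢c ∘ sym))

¬≢0⇒≡0 : ∀ {n} → ¬ (n ≢ 0) → n ≡ 0
¬≢0⇒≡0 {zero}  _ = refl
¬≢0⇒≡0 {suc n} h = ⊥-elim (h λ ())

*≢0⇒ : ∀ a c → a * c ≢ 0 → a ≢ 0 × c ≢ 0
*≢0⇒ a c ac≢0 = (λ { refl → ac≢0 refl }) , (λ { refl → ac≢0 (*-zeroʳ a) })

-- Words in f and g

letter : {A : Set} → (A → A) → (A → A) → FG → A → A
letter F G 𝑓 = F
letter F G 𝑔 = G

applyWordʳ : {A : Set} → (A → A) → (A → A) → {k : ℕ} → Vec FG k → A → A
applyWordʳ F G []      x = x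
applyWordʳ F G (c ∷ w) x = applyWordʳ F G w (letter F G c x)

applyWord-∷ : {A : Set} (F G : A → A) {k : ℕ} (c : FG) (w : Vec FG k) (x : A)
            → applyWord F G (c ∷ w) x ≡ letter F G c (applyWord F G w x)
applyWord-∷ F G 𝑓 w x = refl
applyWord-∷ F G 𝑔 w x = refl

applyWordʳ-∷ʳ : {A : Set} (F G : A → A) {k : ℕ} (w : Vec FG k) (c : FG) (x : A)
              → applyWordʳ F G (w ∷ʳ c) x ≡ letter F G c (applyWordʳ F G w x)
applyWordʳ-∷ʳ F G []      c x = refl
applyWordʳ-∷ʳ F G (d ∷ w) c x = applyWordʳ-∷ʳ F G w c (letter F G d x)

applyWord≡applyWordʳ∘reverse : {A : Set} (F G : A → A) {k : ℕ} (w : Vec FG k) (x : A)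
                              → applyWord F G w x ≡ applyWordʳ F G (reverse w) x
applyWord≡applyWordʳ∘reverse F G [] x = refl
applyWord≡applyWordʳ∘reverse F G (c ∷ w) x = begin
  applyWord F G (c ∷ w) x                 ≡⟨ applyWord-∷ F G c w x ⟩
  letter F G c (applyWord F G w x)         ≡⟨ cong (letter F G c) (applyWord≡applyWordʳ∘reverse F G w x) ⟩
  letter F G c (applyWordʳ F G (reverse w) x) ≡⟨ sym (applyWordʳ-∷ʳ F G (reverse w) c x) ⟩
  applyWordʳ F G (reverse w ∷ʳ c) x        ≡⟨ cong (λ v → applyWordʳ F G v x) (sym (reverse-∷ c w)) ⟩
  applyWordʳ F G (reverse (c ∷ w)) x       ∎
  where open ≡-Reasoning

iter-suc : {A : Set} (F : A → A) (j : ℕ) (x : A) → iter F (suc j) x ≡ iter F j (F x)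
iter-suc F zero    x = refl
iter-suc F (suc j) x = cong F (iter-suc F j x)

iter-+ : {A : Set} (F : A → A) (d i : ℕ) (x : A) → iter F (d + i) x ≡ iter F d (iter F i x)
iter-+ F zero    i x = refl
iter-+ F (suc d) i x = cong F (iter-+ F d i x)

-- Systems of word constraints

Constraints : ℕ → ℕ → Set
Constraints K j = List (Vec FG j × Fin K)

module _ {K : ℕ} where

  branch : {j : ℕ} → FG → Constraints K (suc j) → Constraints K j
  branch c [] = []
  branch 𝑓 ((𝑓 ∷ w , t) ∷ L) = (w , t) ∷ branch 𝑓 L
  branch 𝑓 ((𝑔 ∷ w , t) ∷ L) = branch 𝑓 L
  branch 𝑔 ((𝑓 ∷ w , t) ∷ L) = branch 𝑔 L
  branch 𝑔 ((𝑔 ∷ w , t) ∷ L) = (w , t) ∷ branch 𝑔 L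

  -- All constraint words have length j, so this counts the words of length j carrying no constraint.
  freeWords : (j : ℕ) → Constraints K j → ℕ
  freeWords zero    []      = 1
  freeWords zero    (_ ∷ _) = 0
  freeWords (suc j) L       = freeWords j (branch 𝑓 L) + freeWords j (branch 𝑔 L)

  allEqualF : Fin K → Constraints K 0 → QF K
  allEqualF t []              = ⊤F
  allEqualF t ((_ , t') ∷ L) = (var t' ≐ var t) ∧F allEqualF t L

  consistentF : (j : ℕ) → Constraints K j → QF K
  consistentF zero    []            = ⊤F
  consistentF zero    ((_ , t) ∷ L) = allEqualF t L
  consistentF (suc j) L             = consistentF j (branch 𝑓 L) ∧F consistentF j (branch 𝑔 L)

  truncateAll : {j k : ℕ} → j ≤ k → Constraints K k → Constraints K j
  truncateAll j≤k []            = []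
  truncateAll j≤k ((w , t) ∷ L) = (truncate j≤k w , t) ∷ truncateAll j≤k L

⋀ : ∀ {K} (n : ℕ) → (Fin n → QF K) → QF K
⋀ zero    φ = ⊤F
⋀ (suc n) φ = φ zero ∧F ⋀ n (φ ∘ suc)

syntax ⋀ n (λ i → φ) = ⋀[ i < n ] φ

litF : ∀ {K} → Fin 2 → QF K → QF K
litF zero    φ = ¬F φ
litF (suc _) φ = φ

y₀ : ∀ {m} → Term (suc m)
y₀ = var zero

nonemptyLevelF : ∀ {m} → ℕ → QF (suc m)
nonemptyLevelF zero    = ⊤F
nonemptyLevelF (suc j) = ¬F Cinit+ j y₀

levelF : ∀ {m j k} → j ≤ k → Constraints (suc m) k → QF (suc m)
levelF {j = j} j≤k L = consistentF j (truncateAll j≤k L) ∧F nonemptyLevelF j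

-- Polynomials with natural coefficients

evalℕ : List ℕ → ℕ → ℕ
evalℕ []      c = 0
evalℕ (a ∷ p) c = a + c * evalℕ p c

toPoly : List ℕ → Poly
toPoly = List.map (λ a → ℤ.+ a)

evalPoly-toPoly : ∀ p c → evalPoly (toPoly p) (ℤ.+ c) ≡ ℤ.+ evalℕ p c
evalPoly-toPoly []      c = refl
evalPoly-toPoly (a ∷ p) c =
  trans (cong (ℤ._+_ (ℤ.+ a)) (trans (cong (ℤ._*_ (ℤ.+ c)) (evalPoly-toPoly p c)) (sym (ℤ.pos-* c (evalℕ p c)))))
        (sym (ℤ.pos-+ a (c * evalℕ p c)))

toPoly-nonzero : ∀ p → evalℕ p 1 ≢ 0 → NonZeroPoly (toPoly p)
toPoly-nonzero []            ≢0 = ⊥-elim (≢0 refl)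
toPoly-nonzero (suc a ∷ p)   ≢0 = here λ ()
toPoly-nonzero (zero  ∷ p)   ≢0 = there (toPoly-nonzero p (≢0 ∘ trans (+-identityʳ (evalℕ p 1))))

monomial : ℕ → ℕ → List ℕ
monomial a zero    = a ∷ []
monomial a (suc e) = 0 ∷ monomial a e

evalℕ-monomial : ∀ a e c → evalℕ (monomial a e) c ≡ a * c ^ e
evalℕ-monomial a zero    c = trans (cong (a +_) (*-zeroʳ c)) (trans (+-identityʳ a) (sym (*-identityʳ a)))
evalℕ-monomial a (suc e) c = trans (cong (c *_) (evalℕ-monomial a e c)) (x∙yz≈y∙xz c a (c ^ e))

evalℕ-monomial-1 : ∀ a e → evalℕ (monomial a e) 1 ≡ a
evalℕ-monomial-1 a e = trans (evalℕ-monomial a e 1) (trans (cong (a *_) (^-zeroˡ e)) (*-identityʳ a))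

_⊕_ : List ℕ → List ℕ → List ℕ
[]      ⊕ q       = q
(a ∷ p) ⊕ []      = a ∷ p
(a ∷ p) ⊕ (b ∷ q) = (a + b) ∷ (p ⊕ q)

evalℕ-⊕ : ∀ p q c → evalℕ (p ⊕ q) c ≡ evalℕ p c + evalℕ q c
evalℕ-⊕ []      q       c = refl
evalℕ-⊕ (a ∷ p) []      c = sym (+-identityʳ _)
evalℕ-⊕ (a ∷ p) (b ∷ q) c = begin
  a + b + c * evalℕ (p ⊕ q) c              ≡⟨ cong (λ n → a + b + c * n) (evalℕ-⊕ p q c) ⟩
  a + b + c * (evalℕ p c + evalℕ q c)      ≡⟨ cong (a + b +_) (*-distribˡ-+ c (evalℕ p c) (evalℕ q c)) ⟩
  a + b + (c * evalℕ p c + c * evalℕ q c)  ≡⟨ +-interchange a b _ _ ⟩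
  a + c * evalℕ p c + (b + c * evalℕ q c)  ∎
  where open ≡-Reasoning

∑ₚ : ∀ {n} → (Fin n → List ℕ) → List ℕ
∑ₚ {zero}  P = []
∑ₚ {suc n} P = P zero ⊕ ∑ₚ (P ∘ suc)

evalℕ-∑ₚ : ∀ {n} (P : Fin n → List ℕ) c → evalℕ (∑ₚ P) c ≡ ∑[ j < n ] evalℕ (P j) c
evalℕ-∑ₚ {zero}  P c = refl
evalℕ-∑ₚ {suc n} P c = trans (evalℕ-⊕ (P zero) (∑ₚ (P ∘ suc)) c) (cong (evalℕ (P zero) c +_) (evalℕ-∑ₚ (P ∘ suc) c))

-- The case distinction

module Cases {k m : ℕ} (s : Fin (suc m) → Vec FG k) where

  -- s_t(x) = y_t becomes the innermost-first constraint (reverse s_t , t).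
  constraints : Constraints (suc m) k
  constraints = List.tabulate (λ t → reverse (s t) , t)

  inClassF : QF (suc m)
  inClassF = ⋀[ t < suc m ] Eat (var t) y₀

  movingCaseF : QF (suc m)
  movingCaseF = (¬F (fT y₀ ≐ y₀)) ∧F ((⋀[ i < k ] (¬F Cinit+ (toℕ i) y₀)) ∧F (inClassF ∧F consistentF k constraints))

  levelCaseF : Fin (suc k) → QF (suc m)
  levelCaseF j = levelF (toℕ≤pred[n] j) constraints

  levelExponent : Fin (suc k) → ℕ
  levelExponent j = freeWords (toℕ j) (truncateAll (toℕ≤pred[n] j) constraints)

  -- A pattern records which of the levels C_fin−0, …, C_fin−k contribute solutions.
  Pattern : Set
  Pattern = Fin (suc k) → Fin 2

  someLevel? : (A : Pattern) → Dec (Σ (Fin (suc k)) (λ j → A j ≡ suc zero))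
  someLevel? A = any? (λ j → A j ≟ suc zero)

  fixedCaseF : Pattern → QF (suc m)
  fixedCaseF A =
    if ⌊ someLevel? A ⌋ then (fT y₀ ≐ y₀) ∧F (inClassF ∧F (⋀[ j < suc k ] litF (A j) (levelCaseF j))) else ⊥F

  fixedCasePoly : Pattern → List ℕ
  fixedCasePoly A = if ⌊ someLevel? A ⌋ then ∑ₚ (λ j → monomial (toℕ (A j)) (levelExponent j)) else 1 ∷ []

  cases : ℕ
  cases = suc (2 ^ suc k)

  caseF : Fin cases → QF (suc m)
  caseF zero    = movingCaseF
  caseF (suc l) = fixedCaseF (finToFun l)

  casePoly : Fin cases → List ℕ
  casePoly zero    = monomial 1 (freeWords k constraints)
  casePoly (suc l) = fixedCasePoly (finToFun l)

  casePoly-nonzero : ∀ l → evalℕ (casePoly l) 1 ≢ 0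
  casePoly-nonzero zero ≡0 = 1+n≢0 (trans (sym (evalℕ-monomial-1 1 (freeWords k constraints))) ≡0)
  casePoly-nonzero (suc l) with someLevel? (finToFun l)
  ... | no  _          = λ ()
  ... | yes (j , Aj≡1) = λ ≡0 →
    let A = finToFun l
        P = λ j → monomial (toℕ (A j)) (levelExponent j)
        monomialⱼ≡0 = ∑≡0⇒≡0 (λ j → evalℕ (P j) 1) (trans (sym (evalℕ-∑ₚ P 1)) ≡0) j
    in 1+n≢0 (trans (cong toℕ (sym Aj≡1)) (trans (sym (evalℕ-monomial-1 _ (levelExponent j))) monomialⱼ≡0))

-- Counting in one finite factor

module Factor (M : FinStr) where
  open FinStr M public

  N : ℕ
  N = suc size

  X : Set
  X = Fin N

  _≈_ : X → X → Set
  x ≈ y = E x y ≡ true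

  Fix Pre NoPre : X → Set
  Fix x   = f x ≡ x
  Pre x   = Σ X (λ z → f z ≡ x)
  NoPre x = ¬ Pre x

  Cinit+ᵢ : ℕ → X → Set
  Cinit+ᵢ k t = Σ X (λ x → NoPre x × iter f k x ≡ t)

  Cfin-ᵢ : ℕ → X → Set
  Cfin-ᵢ zero    t = Fix t
  Cfin-ᵢ (suc k) t = Fix (iter f (suc k) t) × ¬ Fix (iter f k t)

  evalᵢ : {K : ℕ} → (Fin K → X) → Term K → X
  evalᵢ b (var j) = b j
  evalᵢ b (fT t)  = f (evalᵢ b t)
  evalᵢ b (gT t)  = g (evalᵢ b t)

  Satᵢ : {K : ℕ} → (Fin K → X) → QF K → Set
  Satᵢ b ⊤F           = ⊤
  Satᵢ b ⊥F           = ⊥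
  Satᵢ b (t ≐ u)      = evalᵢ b t ≡ evalᵢ b u
  Satᵢ b (Eat t u)    = evalᵢ b t ≈ evalᵢ b u
  Satᵢ b (Cinit+ k t) = Cinit+ᵢ k (evalᵢ b t)
  Satᵢ b (Cfin- k t)  = Cfin-ᵢ k (evalᵢ b t)
  Satᵢ b (¬F φ)       = ¬ Satᵢ b φ
  Satᵢ b (φ ∧F ψ)     = Satᵢ b φ × Satᵢ b ψ
  Satᵢ b (φ ∨F ψ)     = Satᵢ b φ ⊎ Satᵢ b ψ

  Fix? : ∀ x → Dec (Fix x)
  Fix? x = f x ≟ x

  Pre? : ∀ x → Dec (Pre x)
  Pre? x = any? (λ z → f z ≟ x)

  Cinit+ᵢ? : ∀ k t → Dec (Cinit+ᵢ k t)
  Cinit+ᵢ? k t = any? (λ x → ¬? (Pre? x) ×-dec (iter f k x ≟ t))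

  Cfin-ᵢ? : ∀ k t → Dec (Cfin-ᵢ k t)
  Cfin-ᵢ? zero    t = Fix? t
  Cfin-ᵢ? (suc k) t = Fix? (iter f (suc k) t) ×-dec ¬? (Fix? (iter f k t))

  Satᵢ? : {K : ℕ} (b : Fin K → X) (φ : QF K) → Dec (Satᵢ b φ)
  Satᵢ? b ⊤F           = yes tt
  Satᵢ? b ⊥F           = no λ ()
  Satᵢ? b (t ≐ u)      = evalᵢ b t ≟ evalᵢ b u
  Satᵢ? b (Eat t u)    = E (evalᵢ b t) (evalᵢ b u) Bool.≟ true
  Satᵢ? b (Cinit+ k t) = Cinit+ᵢ? k (evalᵢ b t)
  Satᵢ? b (Cfin- k t)  = Cfin-ᵢ? k (evalᵢ b t)
  Satᵢ? b (¬F φ)       = ¬? (Satᵢ? b φ)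
  Satᵢ? b (φ ∧F ψ)     = Satᵢ? b φ ×-dec Satᵢ? b ψ
  Satᵢ? b (φ ∨F ψ)     = Satᵢ? b φ ⊎-dec Satᵢ? b ψ

  Satᵢ-⋀ : ∀ {K n} (b : Fin K → X) (φ : Fin n → QF K) → Satᵢ b (⋀ n φ) → ∀ i → Satᵢ b (φ i)
  Satᵢ-⋀ b φ (sat , _)    zero    = sat
  Satᵢ-⋀ b φ (_   , sats) (suc i) = Satᵢ-⋀ b (φ ∘ suc) sats i

  ⋀-intro : ∀ {K n} (b : Fin K → X) (φ : Fin n → QF K) → (∀ i → Satᵢ b (φ i)) → Satᵢ b (⋀ n φ)
  ⋀-intro {n = zero}  b φ sats = tt
  ⋀-intro {n = suc n} b φ sats = sats zero , ⋀-intro b (φ ∘ suc) (sats ∘ suc)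

  bit : {P : Set} → Dec P → Fin 2
  bit (yes _) = suc zero
  bit (no _)  = zero

  litF-bit : ∀ {K} (b : Fin K → X) φ → Satᵢ b (litF (bit (Satᵢ? b φ)) φ)
  litF-bit b φ with Satᵢ? b φ
  ... | yes sat = sat
  ... | no ¬sat = ¬sat

  bit-yes : {P : Set} (d : Dec P) → P → bit d ≡ suc zero
  bit-yes (yes _) _ = refl
  bit-yes (no ¬p) p = ⊥-elim (¬p p)

  litF-𝟙 : ∀ {K} (b : Fin K → X) β φ → Satᵢ b (litF β φ) → 𝟙 ⌊ Satᵢ? b φ ⌋ ≡ toℕ β
  litF-𝟙 b zero          φ ¬sat = 𝟙-no (Satᵢ? b φ) ¬sat
  litF-𝟙 b (suc zero)    φ sat  = 𝟙-yes (Satᵢ? b φ) sat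

  classSize : X → ℕ
  classSize y = ∑[ z < N ] 𝟙 (E z y)

  𝟙solves : {K j : ℕ} → (Fin K → X) → Constraints K j → X → ℕ
  𝟙solves b []            x = 1
  𝟙solves b ((w , t) ∷ L) x = δ (applyWordʳ f g w x) (b t) * 𝟙solves b L x

  module _ {K k : ℕ} (b : Fin K → X) where

    𝟙allFinB≡𝟙solves : ∀ n (w : Fin n → Vec FG k) (ι : Fin n → Fin K) x →
      𝟙 (allFinB n (λ j → ⌊ applyWord f g (w j) x ≟ b (ι j) ⌋))
        ≡ 𝟙solves b (List.tabulate (λ j → reverse (w j) , ι j)) x
    𝟙allFinB≡𝟙solves zero    w ι x = refl
    𝟙allFinB≡𝟙solves (suc n) w ι x = begin
      𝟙 (⌊ applyWord f g (w zero) x ≟ b (ι zero) ⌋ ∧ rest)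
        ≡⟨ 𝟙-∧ ⌊ applyWord f g (w zero) x ≟ b (ι zero) ⌋ rest ⟩
      δ (applyWord f g (w zero) x) (b (ι zero)) * 𝟙 rest
        ≡⟨ cong₂ (λ y n → δ y (b (ι zero)) * n) (applyWord≡applyWordʳ∘reverse f g (w zero) x)
                 (𝟙allFinB≡𝟙solves n (w ∘ suc) (ι ∘ suc) x) ⟩
      𝟙solves b (List.tabulate (λ j → reverse (w j) , ι j)) x ∎
      where
        open ≡-Reasoning
        rest = allFinB n (λ j → ⌊ applyWord f g (w (suc j)) x ≟ b (ι (suc j)) ⌋)

    solves-tabulate : ∀ n (w : Fin n → Vec FG k) (ι : Fin n → Fin K) x →
      (∀ j → applyWord f g (w j) x ≡ b (ι j)) → 𝟙solves b (List.tabulate (λ j → reverse (w j) , ι j)) x ≡ 1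
    solves-tabulate zero    w ι x sol = refl
    solves-tabulate (suc n) w ι x sol =
      cong₂ _*_ (𝟙-yes (applyWordʳ f g (reverse (w zero)) x ≟ b (ι zero))
                       (trans (sym (applyWord≡applyWordʳ∘reverse f g (w zero) x)) (sol zero)))
                (solves-tabulate n (w ∘ suc) (ι ∘ suc) x (sol ∘ suc))

  -- The consequences of T that hold in almost every factor and drive the counting.
  record Axioms : Set where
    field
      ≈-refl          : ∀ x → x ≈ x
      ≈-sym           : ∀ {x y} → x ≈ y → y ≈ x
      ≈-trans         : ∀ {x y z} → x ≈ y → y ≈ z → x ≈ z
      f≈g             : ∀ {x y} → x ≈ y → f x ≈ g y
      Fix⇒g-fixed     : ∀ {x} → Fix x → g x ≡ x
      Fix-resp-≈      : ∀ {x y} → x ≈ y → Fix x → Fix y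
      Fix-≈           : ∀ {x y} → Fix x → Fix y → x ≈ y
      Pre-resp-≈      : ∀ {x y} → x ≈ y → Pre x → Pre y
      f-reflects-≈    : ∀ {x y} → ¬ Fix x → ¬ Fix y → f x ≈ f y → x ≈ y
      ⟨f,g⟩-onto      : ∀ {x y} → x ≈ y → Pre x → Σ X (λ z → ¬ Fix z × f z ≡ x × g z ≡ y)
      ⟨f,g⟩-injective : ∀ {z z'} → ¬ Fix z → ¬ Fix z' → f z ≡ f z' → g z ≡ g z' → z ≡ z'

  Moving : ℕ → X → Set
  Moving zero    x = ⊤
  Moving (suc j) x = ¬ Fix x × Moving j (f x)

  iter-preimage : ∀ n {t} → (∀ (i : Fin n) → ¬ Cinit+ᵢ (toℕ i) t) → Σ X (λ a → iter f n a ≡ t)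
  iter-preimage zero    _ = _ , refl
  iter-preimage (suc n) {t} ¬init with Pre? t
  ... | no ¬pre = ⊥-elim (¬init zero (t , ¬pre , refl))
  ... | yes (z , fz≡t) =
    let (a , e) = iter-preimage n (λ i (x , np , e) → ¬init (suc i) (x , np , trans (cong f e) fz≡t))
    in a , trans (cong f e) fz≡t

  module WithAxioms (ax : Axioms) where
    open Axioms ax

    f-resp-≈ : ∀ {x y} → x ≈ y → f x ≈ f y
    f-resp-≈ {y = y} x≈y = ≈-trans (f≈g x≈y) (≈-sym (f≈g (≈-refl y)))

    letter-≈ : ∀ c d {x y} → x ≈ y → letter f g c x ≈ letter f g d y
    letter-≈ 𝑓 𝑓 x≈y = f-resp-≈ x≈y
    letter-≈ 𝑓 𝑔 x≈y = f≈g x≈y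
    letter-≈ 𝑔 𝑓 x≈y = ≈-sym (f≈g (≈-sym x≈y))
    letter-≈ 𝑔 𝑔 {x} x≈y = ≈-trans (≈-sym (f≈g (≈-refl x))) (f≈g x≈y)

    iter-resp-≈ : ∀ j {x y} → x ≈ y → iter f j x ≈ iter f j y
    iter-resp-≈ zero    x≈y = x≈y
    iter-resp-≈ (suc j) x≈y = f-resp-≈ (iter-resp-≈ j x≈y)

    iter≈applyWordʳ : ∀ {j} (w : Vec FG j) x → iter f j x ≈ applyWordʳ f g w x
    iter≈applyWordʳ []      x = ≈-refl x
    iter≈applyWordʳ {suc j} (c ∷ w) x =
      subst (_≈ applyWordʳ f g w (letter f g c x)) (sym (iter-suc f j x))
        (≈-trans (iter-resp-≈ j (letter-≈ 𝑓 c (≈-refl x))) (iter≈applyWordʳ w (letter f g c x)))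

    Fix⇒iter-fixed : ∀ j {x} → Fix x → iter f j x ≡ x
    Fix⇒iter-fixed zero    _  = refl
    Fix⇒iter-fixed (suc j) fx = trans (cong f (Fix⇒iter-fixed j fx)) fx

    Fix⇒applyWordʳ-fixed : ∀ {j} (w : Vec FG j) {x} → Fix x → applyWordʳ f g w x ≡ x
    Fix⇒applyWordʳ-fixed []      fx = refl
    Fix⇒applyWordʳ-fixed (𝑓 ∷ w) fx = trans (cong (applyWordʳ f g w) fx) (Fix⇒applyWordʳ-fixed w fx)
    Fix⇒applyWordʳ-fixed (𝑔 ∷ w) fx = trans (cong (applyWordʳ f g w) (Fix⇒g-fixed fx)) (Fix⇒applyWordʳ-fixed w fx)

    ¬Fix-iter⇒Moving : ∀ j {x} → ¬ Fix (iter f j x) → Moving (suc j) x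
    ¬Fix-iter⇒Moving zero    ¬fx = ¬fx , tt
    ¬Fix-iter⇒Moving (suc j) {x} ¬fx =
      (λ fx → ¬fx (subst Fix (sym (Fix⇒iter-fixed (suc j) fx)) fx)) ,
      ¬Fix-iter⇒Moving j (¬fx ∘ subst Fix (sym (iter-suc f j x)))

    Moving-weaken : ∀ j {x} → Moving (suc j) x → Moving j x
    Moving-weaken zero    _           = tt
    Moving-weaken (suc j) (¬fx , mov) = ¬fx , Moving-weaken j mov

    above-nonfixed⇒Moving : ∀ j {x c} → ¬ Fix c → iter f j x ≈ c → Moving j x
    above-nonfixed⇒Moving j ¬fc x≈c = Moving-weaken j (¬Fix-iter⇒Moving j (¬fc ∘ Fix-resp-≈ x≈c))

    iter-reflects-≈ : ∀ j {x y} → Moving j x → Moving j y → iter f j x ≈ iter f j y → x ≈ y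
    iter-reflects-≈ zero    _              _              x≈y = x≈y
    iter-reflects-≈ (suc j) {x} {y} (¬fx , movx) (¬fy , movy) eq =
      f-reflects-≈ ¬fx ¬fy (iter-reflects-≈ j movx movy (subst₂ _≈_ (iter-suc f j x) (iter-suc f j y) eq))

    Cfin⇒Fix : ∀ j {x} → Cfin-ᵢ j x → Fix (iter f j x)
    Cfin⇒Fix zero    fx       = fx
    Cfin⇒Fix (suc j) (fx , _) = fx

    Cfin⇒Moving : ∀ j {x} → Cfin-ᵢ j x → Moving j x
    Cfin⇒Moving zero    _         = tt
    Cfin⇒Moving (suc j) (_ , ¬fx) = ¬Fix-iter⇒Moving j ¬fx

    Cfin-≈ : ∀ j {x y} → Cfin-ᵢ j x → Cfin-ᵢ j y → x ≈ y
    Cfin-≈ j cx cy = iter-reflects-≈ j (Cfin⇒Moving j cx) (Cfin⇒Moving j cy) (Fix-≈ (Cfin⇒Fix j cx) (Cfin⇒Fix j cy))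

    Cfin-resp-≈ : ∀ j {x y} → x ≈ y → Cfin-ᵢ j x → Cfin-ᵢ j y
    Cfin-resp-≈ zero    x≈y fx        = Fix-resp-≈ x≈y fx
    Cfin-resp-≈ (suc j) x≈y (fx , ¬fx) =
      Fix-resp-≈ (iter-resp-≈ (suc j) x≈y) fx , ¬fx ∘ Fix-resp-≈ (iter-resp-≈ j (≈-sym x≈y))

    Cfin-f : ∀ j {x} → Cfin-ᵢ (suc j) x → Cfin-ᵢ j (f x)
    Cfin-f zero    (fx , _)   = fx
    Cfin-f (suc j) {x} (fx , ¬fx) =
      subst Fix (iter-suc f (suc j) x) fx , ¬fx ∘ subst Fix (sym (iter-suc f j x))

    classSize-resp-≈ : ∀ {x y} → x ≈ y → classSize x ≡ classSize y
    classSize-resp-≈ {x} {y} x≈y = sum-cong-≗ {N} λ z →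
      cong 𝟙 (Bool.⇔→≡ {E z x} {E z y} {true} (mk⇔ (λ z≈x → ≈-trans z≈x x≈y) (λ z≈y → ≈-trans z≈y (≈-sym x≈y))))

    Fix-iter-mono : ∀ {i j x} → i ≤ j → Fix (iter f i x) → Fix (iter f j x)
    Fix-iter-mono {i} {j} {x} i≤j fix with m≤n⇒∃[o]m+o≡n i≤j
    ... | d , refl = subst Fix (sym (trans (cong (λ n → iter f n x) (+-comm i d)) (iter-+ f d i x)))
                           (subst Fix (sym (Fix⇒iter-fixed d fix)) fix)

    Cinit-mono : ∀ {i j c} → Fix c → i ≤ j → Cinit+ᵢ i c → Cinit+ᵢ j c
    Cinit-mono {i} {j} fc i≤j (x , np , e) with m≤n⇒∃[o]m+o≡n i≤j
    ... | d , refl = x , np , trans (cong (λ n → iter f n x) (+-comm i d))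
                                  (trans (iter-+ f d i x) (trans (cong (iter f d) e) (Fix⇒iter-fixed d fc)))

    Cfin-unique : ∀ {i j x} → Cfin-ᵢ i x → Cfin-ᵢ j x → i ≡ j
    Cfin-unique {i} {j} ci cj with <-cmp i j
    ... | tri≈ _ i≡j _ = i≡j
    ... | tri< (s≤s i≤j′) _ _ = ⊥-elim (proj₂ cj (Fix-iter-mono i≤j′ (Cfin⇒Fix i ci)))
    ... | tri> _ _ (s≤s j≤i′) = ⊥-elim (proj₂ ci (Fix-iter-mono j≤i′ (Cfin⇒Fix j cj)))

    level-of : ∀ k {x} → Fix (iter f k x) → Σ (Fin (suc k)) (λ j → Cfin-ᵢ (toℕ j) x)
    level-of zero    fix = zero , fix
    level-of (suc k) {x} fix with Fix? (iter f k x)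
    ... | no ¬fix = fromℕ (suc k) , subst (λ n → Cfin-ᵢ n x) (sym (toℕ-fromℕ (suc k))) (fix , ¬fix)
    ... | yes fix′ = let (j , cj) = level-of k fix′
                     in inject₁ j , subst (λ n → Cfin-ᵢ n x) (sym (toℕ-inject₁ j)) cj

    ∑-levels : ∀ k {x} → Fix (iter f k x) → ∀ h → ∑[ j < suc k ] (𝟙 ⌊ Cfin-ᵢ? (toℕ j) x ⌋ * h) ≡ h
    ∑-levels k {x} fix h with level-of k fix
    ... | ℓ , cℓ = trans (∑-single ℓ _ off) (trans (cong (_* h) (𝟙-yes (Cfin-ᵢ? (toℕ ℓ) x) cℓ)) (*-identityˡ h))
      where
        off : ∀ j → j ≢ ℓ → 𝟙 ⌊ Cfin-ᵢ? (toℕ j) x ⌋ * h ≡ 0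
        off j j≢ℓ = cong (_* h) (𝟙-no (Cfin-ᵢ? (toℕ j) x) λ cj → j≢ℓ (toℕ-injective (Cfin-unique cj cℓ)))

    moving⇒¬Cinit : ∀ k {x c} → ¬ Fix c → iter f k x ≈ c → ∀ (i : Fin k) → ¬ Cinit+ᵢ (toℕ i) c
    moving⇒¬Cinit k {x} {c} ¬fc x≈c i (y , ¬pre , e) with m≤n⇒∃[o]m+o≡n (toℕ<n i)
    ... | o , split = ¬pre (Pre-resp-≈ z≈y (iter f o x , refl))
      where
        z = iter f (suc o) x
        iz≈c : iter f (toℕ i) z ≈ c
        iz≈c = subst (_≈ c) (trans (cong (λ n → iter f n x) (sym (trans (+-suc (toℕ i) o) split)))
                                   (iter-+ f (toℕ i) (suc o) x)) x≈c
        iy≈c : iter f (toℕ i) y ≈ c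
        iy≈c = subst (_≈ c) (sym e) (≈-refl c)
        z≈y = iter-reflects-≈ (toℕ i) (above-nonfixed⇒Moving (toℕ i) ¬fc iz≈c) (above-nonfixed⇒Moving (toℕ i) ¬fc iy≈c)
                              (≈-trans iz≈c (≈-sym iy≈c))

    -- For c ∈ C_fin, the level C_fin−(j+1) is empty exactly when C_init reaches c in j steps.
    NonemptyLevel : ℕ → X → Set
    NonemptyLevel zero    c = ⊤
    NonemptyLevel (suc j) c = ¬ Cinit+ᵢ j c

    level-nonempty : ∀ j {x c} → Fix c → Cfin-ᵢ j x → NonemptyLevel j c
    level-nonempty zero    _  _ = tt
    level-nonempty (suc j) fc cx (y , ¬pre , e) = no-level j ¬pre (subst Fix (sym e) fc) cx
      where
        no-level : ∀ j {x y} → NoPre y → Fix (iter f j y) → ¬ Cfin-ᵢ (suc j) x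
        no-level zero    {y = y} ¬pre fy _ = ¬pre (y , fy)
        no-level (suc j) {x} {y} ¬pre fy cx with Fix? (iter f j y)
        ... | yes fy′ = no-level j ¬pre fy′ (Cfin-f (suc j) cx)
        ... | no ¬fy′ = ¬pre (Pre-resp-≈ (Cfin-≈ (suc j) (Cfin-f (suc j) cx) (fy , ¬fy′)) (x , refl))

    level-representative : ∀ j {c} → Fix c → NonemptyLevel j c → Σ X (Cfin-ᵢ j)
    level-representative zero    {c} fc _ = c , fc
    level-representative (suc j) {c} fc ¬init =
      a , subst Fix (sym (trans (cong f iter-a) fz≡c)) fc , ¬fz ∘ subst Fix iter-a
      where
        z-spec = ⟨f,g⟩-onto (≈-refl c) (c , fc)
        z = proj₁ z-spec
        ¬fz = proj₁ (proj₂ z-spec)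
        fz≡c = proj₁ (proj₂ (proj₂ z-spec))
        a-spec = iter-preimage j {z} λ i (x , np , e) →
          ¬init (Cinit-mono fc (toℕ<n i) (x , np , trans (cong f e) fz≡c))
        a = proj₁ a-spec
        iter-a = proj₂ a-spec

    applyWordʳ-truncate : ∀ {j k} (j≤k : j ≤ k) (w : Vec FG k) x → Fix (iter f j x) →
      applyWordʳ f g w x ≡ applyWordʳ f g (truncate j≤k w) x
    applyWordʳ-truncate {zero}  _         w       x fix = Fix⇒applyWordʳ-fixed w fix
    applyWordʳ-truncate {suc j} (s≤s j≤k) (c ∷ w) x fix =
      applyWordʳ-truncate j≤k w (letter f g c x)
        (Fix-resp-≈ (iter-resp-≈ j (letter-≈ 𝑓 c (≈-refl x))) (subst Fix (iter-suc f j x) fix))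

    VarsIn : ∀ {K j} → (Fin K → X) → X → Constraints K j → Set
    VarsIn b c = All (λ (_ , t) → b t ≈ c)

    VarsIn-≈ : ∀ {K j} {b : Fin K → X} {c c′} {L : Constraints K j} → c ≈ c′ → VarsIn b c L → VarsIn b c′ L
    VarsIn-≈ c≈c′ = All.map (λ bt≈c → ≈-trans bt≈c c≈c′)

    VarsIn-truncate : ∀ {K j k} {b : Fin K → X} {c} (j≤k : j ≤ k) (L : Constraints K k) →
      VarsIn b c L → VarsIn b c (truncateAll j≤k L)
    VarsIn-truncate j≤k []            []         = []
    VarsIn-truncate j≤k ((w , t) ∷ L) (p ∷ ps) = p ∷ VarsIn-truncate j≤k L ps

    VarsIn-branch : ∀ {K j} {b : Fin K → X} {c} d (L : Constraints K (suc j)) → VarsIn b c L → VarsIn b c (branch d L)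
    VarsIn-branch d   []                   _        = []
    VarsIn-branch 𝑓 ((𝑓 ∷ w , t) ∷ L) (p ∷ ps) = p ∷ VarsIn-branch 𝑓 L ps
    VarsIn-branch 𝑓 ((𝑔 ∷ w , t) ∷ L) (p ∷ ps) = VarsIn-branch 𝑓 L ps
    VarsIn-branch 𝑔 ((𝑓 ∷ w , t) ∷ L) (p ∷ ps) = VarsIn-branch 𝑔 L ps
    VarsIn-branch 𝑔 ((𝑔 ∷ w , t) ∷ L) (p ∷ ps) = p ∷ VarsIn-branch 𝑔 L ps

    fibre : X → X → X → X → ℕ
    fibre a x u v = δ (f x) u * (δ (g x) v * 𝟙 (E x a))

    fibre-member : ∀ {a u v} x → fibre a x u v ≢ 0 → f x ≡ u × g x ≡ v × x ≈ a
    fibre-member {a} {u} {v} x ≢0 =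
      let (δu≢0 , rest) = *≢0⇒ (δ (f x) u) _ ≢0
          (δv≢0 , xa≢0) = *≢0⇒ (δ (g x) v) _ rest
      in 𝟙≢0⇒ (f x ≟ u) δu≢0 , 𝟙≢0⇒ (g x ≟ v) δv≢0 , 𝟙≢0⇒true xa≢0

    -- For a ∉ C_fin, x ↦ (f x , g x) maps the class of a bijectively onto (class of f a)², by (e) and (f).
    fibre-size : ∀ {a} → ¬ Fix a → ∀ u v → ∑[ x < N ] fibre a x u v ≡ 𝟙 (E u (f a)) * 𝟙 (E v (f a))
    fibre-size {a} ¬fa u v with E u (f a) in u≈fa | E v (f a) in v≈fa
    ... | true | true = trans (∑-single z _ off) at-z
      where
        z-spec = ⟨f,g⟩-onto (≈-trans u≈fa (≈-sym v≈fa)) (Pre-resp-≈ (≈-sym u≈fa) (a , refl))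
        z = proj₁ z-spec
        ¬fz = proj₁ (proj₂ z-spec)
        fz≡u = proj₁ (proj₂ (proj₂ z-spec))
        gz≡v = proj₂ (proj₂ (proj₂ z-spec))
        z≈a : z ≈ a
        z≈a = f-reflects-≈ ¬fz ¬fa (subst (_≈ f a) (sym fz≡u) u≈fa)
        at-z : fibre a z u v ≡ 1
        at-z = cong₂ _*_ (𝟙-yes (f z ≟ u) fz≡u) (cong₂ _*_ (𝟙-yes (g z ≟ v) gz≡v) (cong 𝟙 z≈a))
        off : ∀ x → x ≢ z → fibre a x u v ≡ 0
        off x x≢z = ¬≢0⇒≡0 λ ≢0 →
          let (fx≡u , gx≡v , x≈a) = fibre-member x ≢0
          in x≢z (⟨f,g⟩-injective (¬fa ∘ Fix-resp-≈ x≈a) ¬fz (trans fx≡u (sym fz≡u)) (trans gx≡v (sym gz≡v)))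
    ... | true | false = ∑-zero (λ x → fibre a x u v) λ x → ¬≢0⇒≡0 λ ≢0 →
      let (_ , gx≡v , x≈a) = fibre-member x ≢0
      in true≢false (trans (sym (subst (_≈ f a) gx≡v (letter-≈ 𝑔 𝑓 x≈a))) v≈fa)
    ... | false | _ = ∑-zero (λ x → fibre a x u v) λ x → ¬≢0⇒≡0 λ ≢0 →
      let (fx≡u , _ , x≈a) = fibre-member x ≢0
      in true≢false (trans (sym (subst (_≈ f a) fx≡u (f-resp-≈ x≈a))) u≈fa)

    ∑∑-fibre : ∀ a (H : X → X → ℕ) x → ∑[ u < N ] ∑[ v < N ] (fibre a x u v * H u v) ≡ 𝟙 (E x a) * H (f x) (g x)
    ∑∑-fibre a H x = begin
      ∑[ u < N ] ∑[ v < N ] (fibre a x u v * H u v)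
        ≡⟨ sum-cong-≗ {N} (λ u → sum-cong-≗ {N} (λ v → reassoc u v)) ⟩
      ∑[ u < N ] ∑[ v < N ] (δ (f x) u * (δ (g x) v * (𝟙 (E x a) * H u v)))
        ≡⟨ sum-cong-≗ {N} (λ u → sym (*-distribˡ-sum (δ (f x) u) (λ v → δ (g x) v * (𝟙 (E x a) * H u v)))) ⟩
      ∑[ u < N ] (δ (f x) u * ∑[ v < N ] (δ (g x) v * (𝟙 (E x a) * H u v)))
        ≡⟨ sum-cong-≗ {N} (λ u → cong (δ (f x) u *_) (∑-δ (g x) (λ v → 𝟙 (E x a) * H u v))) ⟩
      ∑[ u < N ] (δ (f x) u * (𝟙 (E x a) * H u (g x)))
        ≡⟨ ∑-δ (f x) (λ u → 𝟙 (E x a) * H u (g x)) ⟩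
      𝟙 (E x a) * H (f x) (g x) ∎
      where
        open ≡-Reasoning
        reassoc : ∀ u v → fibre a x u v * H u v ≡ δ (f x) u * (δ (g x) v * (𝟙 (E x a) * H u v))
        reassoc u v = trans (*-assoc (δ (f x) u) _ _) (cong (δ (f x) u *_) (*-assoc (δ (g x) v) _ _))

    ∑-class-split : ∀ {a} → ¬ Fix a → (H₁ H₂ : X → ℕ) →
      ∑[ x < N ] (𝟙 (E x a) * (H₁ (f x) * H₂ (g x)))
        ≡ ∑[ u < N ] (𝟙 (E u (f a)) * H₁ u) * ∑[ v < N ] (𝟙 (E v (f a)) * H₂ v)
    ∑-class-split {a} ¬fa H₁ H₂ = begin
      ∑[ x < N ] (𝟙 (E x a) * (H₁ (f x) * H₂ (g x)))
        ≡⟨ sum-cong-≗ {N} (sym ∘ ∑∑-fibre a H) ⟩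
      ∑[ x < N ] ∑[ u < N ] ∑[ v < N ] (fibre a x u v * H u v)
        ≡⟨ ∑-comm (λ x u → ∑[ v < N ] (fibre a x u v * H u v)) ⟩
      ∑[ u < N ] ∑[ x < N ] ∑[ v < N ] (fibre a x u v * H u v)
        ≡⟨ sum-cong-≗ {N} (λ u → ∑-comm (λ x v → fibre a x u v * H u v)) ⟩
      ∑[ u < N ] ∑[ v < N ] ∑[ x < N ] (fibre a x u v * H u v)
        ≡⟨ sum-cong-≗ {N} (λ u → sum-cong-≗ {N} (λ v → sym (*-distribʳ-sum (H u v) (λ x → fibre a x u v)))) ⟩
      ∑[ u < N ] ∑[ v < N ] (∑[ x < N ] fibre a x u v * H u v)
        ≡⟨ sum-cong-≗ {N} (λ u → sum-cong-≗ {N} (λ v → cong (_* H u v) (fibre-size ¬fa u v))) ⟩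
      ∑[ u < N ] ∑[ v < N ] ((𝟙 (E u (f a)) * 𝟙 (E v (f a))) * (H₁ u * H₂ v))
        ≡⟨ sum-cong-≗ {N} (λ u → sum-cong-≗ {N} (λ v → interchange (𝟙 (E u (f a))) (𝟙 (E v (f a))) (H₁ u) (H₂ v))) ⟩
      ∑[ u < N ] ∑[ v < N ] ((𝟙 (E u (f a)) * H₁ u) * (𝟙 (E v (f a)) * H₂ v))
        ≡⟨ sum-cong-≗ {N} (λ u → sym (*-distribˡ-sum (𝟙 (E u (f a)) * H₁ u) (λ v → 𝟙 (E v (f a)) * H₂ v))) ⟩
      ∑[ u < N ] ((𝟙 (E u (f a)) * H₁ u) * ∑[ v < N ] (𝟙 (E v (f a)) * H₂ v))
        ≡⟨ sym (*-distribʳ-sum _ (λ u → 𝟙 (E u (f a)) * H₁ u)) ⟩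
      ∑[ u < N ] (𝟙 (E u (f a)) * H₁ u) * ∑[ v < N ] (𝟙 (E v (f a)) * H₂ v) ∎
      where
        open ≡-Reasoning
        H : X → X → ℕ
        H u v = H₁ u * H₂ v

    module _ {K : ℕ} (b : Fin K → X) where

      𝟙solves-branch : ∀ {j} (L : Constraints K (suc j)) x →
        𝟙solves b L x ≡ 𝟙solves b (branch 𝑓 L) (f x) * 𝟙solves b (branch 𝑔 L) (g x)
      𝟙solves-branch [] x = refl
      𝟙solves-branch ((𝑓 ∷ w , t) ∷ L) x =
        trans (cong (d *_) (𝟙solves-branch L x)) (sym (*-assoc d _ _))
        where d = δ (applyWordʳ f g w (f x)) (b t)
      𝟙solves-branch ((𝑔 ∷ w , t) ∷ L) x =
        trans (cong (d *_) (𝟙solves-branch L x)) (x∙yz≈y∙xz d (𝟙solves b (branch 𝑓 L) (f x)) _)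
        where d = δ (applyWordʳ f g w (g x)) (b t)

      allEqual-sound : ∀ t (L : Constraints K 0) x → b t ≡ x → 𝟙solves b L x ≢ 0 → Satᵢ b (allEqualF t L)
      allEqual-sound t []               x bt≡x ≢0 = tt
      allEqual-sound t (([] , t') ∷ L) x bt≡x ≢0 =
        let (δ≢0 , rest) = *≢0⇒ (δ x (b t')) _ ≢0
        in trans (sym (𝟙≢0⇒ (x ≟ b t') δ≢0)) (sym bt≡x) , allEqual-sound t L x bt≡x rest

      consistent-sound : ∀ j (L : Constraints K j) x → 𝟙solves b L x ≢ 0 → Satᵢ b (consistentF j L)
      consistent-sound zero    []              x ≢0 = tt
      consistent-sound zero    (([] , t) ∷ L) x ≢0 =
        let (δ≢0 , rest) = *≢0⇒ (δ x (b t)) _ ≢0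
        in allEqual-sound t L x (sym (𝟙≢0⇒ (x ≟ b t) δ≢0)) rest
      consistent-sound (suc j) L x ≢0 =
        let (≢0𝑓 , ≢0𝑔) = *≢0⇒ _ _ (≢0 ∘ trans (𝟙solves-branch L x))
        in consistent-sound j (branch 𝑓 L) (f x) ≢0𝑓 , consistent-sound j (branch 𝑔 L) (g x) ≢0𝑔

      allEqual-solves : ∀ t (L : Constraints K 0) → Satᵢ b (allEqualF t L) → 𝟙solves b L (b t) ≡ 1
      allEqual-solves t []               _          = refl
      allEqual-solves t (([] , t') ∷ L) (eq , sat) =
        cong₂ _*_ (𝟙-yes (b t ≟ b t') (sym eq)) (allEqual-solves t L sat)

      -- Via ∑-class-split, the f- and g-branches of the system are solved independently in the class of f a.
      class-count : ∀ j {a} → Moving j a → (L : Constraints K j) → VarsIn b (iter f j a) L →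
        Satᵢ b (consistentF j L) →
        ∑[ x < N ] (𝟙 (E x a) * 𝟙solves b L x) ≡ classSize (iter f j a) ^ freeWords j L
      class-count zero {a} _ [] _ _ =
        trans (sum-cong-≗ {N} (λ x → *-identityʳ (𝟙 (E x a)))) (sym (*-identityʳ (classSize a)))
      class-count zero {a} _ (([] , t) ∷ L) (bt≈a ∷ _) sat =
        trans (∑-single (b t) _ off) at-bt
        where
          at-bt : 𝟙 (E (b t) a) * (δ (b t) (b t) * 𝟙solves b L (b t)) ≡ 1
          at-bt = cong₂ _*_ (cong 𝟙 bt≈a) (cong₂ _*_ (𝟙-yes (b t ≟ b t) refl) (allEqual-solves t L sat))
          off : ∀ x → x ≢ b t → 𝟙 (E x a) * (δ x (b t) * 𝟙solves b L x) ≡ 0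
          off x x≢bt = trans (cong (λ d → 𝟙 (E x a) * (d * 𝟙solves b L x)) (𝟙-no (x ≟ b t) x≢bt))
                             (*-zeroʳ (𝟙 (E x a)))
      class-count (suc j) {a} (¬fa , mov) L vars (sat𝑓 , sat𝑔) = begin
        ∑[ x < N ] (𝟙 (E x a) * 𝟙solves b L x)
          ≡⟨ sum-cong-≗ {N} (λ x → cong (𝟙 (E x a) *_) (𝟙solves-branch L x)) ⟩
        ∑[ x < N ] (𝟙 (E x a) * (𝟙solves b L𝑓 (f x) * 𝟙solves b L𝑔 (g x)))
          ≡⟨ ∑-class-split ¬fa (𝟙solves b L𝑓) (𝟙solves b L𝑔) ⟩
        ∑[ u < N ] (𝟙 (E u (f a)) * 𝟙solves b L𝑓 u) * ∑[ v < N ] (𝟙 (E v (f a)) * 𝟙solves b L𝑔 v)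
          ≡⟨ cong₂ _*_ (class-count j mov L𝑓 (VarsIn-branch 𝑓 L vars′) sat𝑓)
                       (class-count j mov L𝑔 (VarsIn-branch 𝑔 L vars′) sat𝑔) ⟩
        c ^ freeWords j L𝑓 * c ^ freeWords j L𝑔
          ≡⟨ sym (^-distribˡ-+-* c (freeWords j L𝑓) (freeWords j L𝑔)) ⟩
        c ^ freeWords (suc j) L
          ≡⟨ cong (λ y → classSize y ^ freeWords (suc j) L) (sym (iter-suc f j a)) ⟩
        classSize (iter f (suc j) a) ^ freeWords (suc j) L ∎
        where
          open ≡-Reasoning
          L𝑓 = branch 𝑓 L
          L𝑔 = branch 𝑔 L
          c = classSize (iter f j (f a))
          vars′ : VarsIn b (iter f j (f a)) L
          vars′ = subst (λ y → VarsIn b y L) (iter-suc f j a) vars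

      solution-VarsIn : ∀ {j} (L : Constraints K j) x → 𝟙solves b L x ≢ 0 → VarsIn b (iter f j x) L
      solution-VarsIn []            x _  = []
      solution-VarsIn ((w , t) ∷ L) x ≢0 =
        let (δ≢0 , rest) = *≢0⇒ (δ (applyWordʳ f g w x) (b t)) _ ≢0
        in ≈-sym (subst (_ ≈_) (𝟙≢0⇒ (applyWordʳ f g w x ≟ b t) δ≢0) (iter≈applyWordʳ w x))
           ∷ solution-VarsIn L x rest

      moving-count : ∀ k {c} → ¬ Fix c → (∀ (i : Fin k) → ¬ Cinit+ᵢ (toℕ i) c) →
        (L : Constraints K k) → VarsIn b c L → (∀ x → 𝟙solves b L x ≢ 0 → iter f k x ≈ c) →
        Satᵢ b (consistentF k L) → ∑[ x < N ] 𝟙solves b L x ≡ classSize c ^ freeWords k L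
      moving-count k {c} ¬fc ¬init L vars above consistent = begin
        ∑[ x < N ] 𝟙solves b L x
          ≡⟨ ∑-restrict (λ x → E x a) (𝟙solves b L) in-class ⟩
        ∑[ x < N ] (𝟙 (E x a) * 𝟙solves b L x)
          ≡⟨ class-count k mov-a L (subst (λ y → VarsIn b y L) (sym iter-a) vars) consistent ⟩
        classSize (iter f k a) ^ freeWords k L
          ≡⟨ cong (λ y → classSize y ^ freeWords k L) iter-a ⟩
        classSize c ^ freeWords k L ∎
        where
          open ≡-Reasoning
          a-spec = iter-preimage k ¬init
          a = proj₁ a-spec
          iter-a = proj₂ a-spec
          mov-a = above-nonfixed⇒Moving k ¬fc (subst (_≈ c) (sym iter-a) (≈-refl c))
          in-class : ∀ x → 𝟙solves b L x ≢ 0 → x ≈ a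
          in-class x ≢0 =
            let x≈c = above x ≢0
            in iter-reflects-≈ k (above-nonfixed⇒Moving k ¬fc x≈c) mov-a (≈-trans x≈c (subst (c ≈_) (sym iter-a) (≈-refl c)))

      truncate-solves : ∀ {j k} (j≤k : j ≤ k) (L : Constraints K k) x → Fix (iter f j x) →
        𝟙solves b L x ≡ 𝟙solves b (truncateAll j≤k L) x
      truncate-solves j≤k []            x fix = refl
      truncate-solves j≤k ((w , t) ∷ L) x fix =
        cong₂ (λ y n → δ y (b t) * n) (applyWordʳ-truncate j≤k w x fix) (truncate-solves j≤k L x fix)

    module _ {m : ℕ} (b : Fin (suc m) → X) where

      nonemptyLevelF-sound : ∀ j → Satᵢ b (nonemptyLevelF j) → NonemptyLevel j (b zero)
      nonemptyLevelF-sound zero    sat = sat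
      nonemptyLevelF-sound (suc j) sat = sat

      nonemptyLevelF-complete : ∀ j → NonemptyLevel j (b zero) → Satᵢ b (nonemptyLevelF j)
      nonemptyLevelF-complete zero    ne = ne
      nonemptyLevelF-complete (suc j) ne = ne

      -- The solutions on level j are those of the truncated system inside the single class C_fin−j.
      level-count : ∀ {j k} (j≤k : j ≤ k) (L : Constraints (suc m) k) → Fix (b zero) → VarsIn b (b zero) L →
        ∑[ x < N ] (𝟙 ⌊ Cfin-ᵢ? j x ⌋ * 𝟙solves b L x)
          ≡ 𝟙 ⌊ Satᵢ? b (levelF j≤k L) ⌋ * classSize (b zero) ^ freeWords j (truncateAll j≤k L)
      level-count {j} j≤k L fc vars with Satᵢ? b (levelF j≤k L)
      ... | yes (consistent , nonempty) = begin
        ∑[ x < N ] (𝟙 ⌊ Cfin-ᵢ? j x ⌋ * 𝟙solves b L x)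
          ≡⟨ sum-cong-≗ {N} on-level ⟩
        ∑[ x < N ] (𝟙 (E x a) * 𝟙solves b Lⱼ x)
          ≡⟨ class-count b j (Cfin⇒Moving j ca) Lⱼ (VarsIn-≈ c≈a (VarsIn-truncate j≤k L vars)) consistent ⟩
        classSize (iter f j a) ^ freeWords j Lⱼ
          ≡⟨ cong (λ y → y ^ freeWords j Lⱼ) (classSize-resp-≈ (≈-sym c≈a)) ⟩
        classSize (b zero) ^ freeWords j Lⱼ
          ≡⟨ sym (*-identityˡ _) ⟩
        1 * classSize (b zero) ^ freeWords j Lⱼ ∎
        where
          open ≡-Reasoning
          Lⱼ = truncateAll j≤k L
          a-spec = level-representative j fc (nonemptyLevelF-sound j nonempty)
          a = proj₁ a-spec
          ca = proj₂ a-spec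
          c≈a : b zero ≈ iter f j a
          c≈a = Fix-≈ fc (Cfin⇒Fix j ca)
          on-level : ∀ x → 𝟙 ⌊ Cfin-ᵢ? j x ⌋ * 𝟙solves b L x ≡ 𝟙 (E x a) * 𝟙solves b Lⱼ x
          on-level x with Cfin-ᵢ? j x
          ... | yes cx = cong₂ _*_ (cong 𝟙 (sym (Cfin-≈ j cx ca))) (truncate-solves b j≤k L x (Cfin⇒Fix j cx))
          ... | no ¬cx =
            sym (cong (λ β → 𝟙 β * 𝟙solves b Lⱼ x) (Bool.¬-not λ x≈a → ¬cx (Cfin-resp-≈ j (≈-sym x≈a) ca)))
      ... | no ¬level = ∑-zero _ λ x → ¬≢0⇒≡0 λ ≢0 →
        let (level≢0 , sol≢0) = *≢0⇒ (𝟙 ⌊ Cfin-ᵢ? j x ⌋) _ ≢0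
            cx = 𝟙≢0⇒ (Cfin-ᵢ? j x) level≢0
            solⱼ≢0 = sol≢0 ∘ trans (truncate-solves b j≤k L x (Cfin⇒Fix j cx))
        in ¬level (consistent-sound b j (truncateAll j≤k L) x solⱼ≢0 ,
                   nonemptyLevelF-complete j (level-nonempty j fc cx))

      fixed-level : ∀ {k} (L : Constraints (suc m) k) x → Fix (b zero) → iter f k x ≈ b zero →
        𝟙solves b L x ≢ 0 → Σ (Fin (suc k)) (λ j → Satᵢ b (levelF (toℕ≤pred[n] j) L))
      fixed-level {k} L x fc x≈c ≢0 with level-of k (Fix-resp-≈ (≈-sym x≈c) fc)
      ... | ℓ , cℓ =
        ℓ , consistent-sound b (toℕ ℓ) (truncateAll ℓ≤k L) x (≢0 ∘ trans (truncate-solves b ℓ≤k L x (Cfin⇒Fix (toℕ ℓ) cℓ))) ,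
            nonemptyLevelF-complete (toℕ ℓ) (level-nonempty (toℕ ℓ) fc cℓ)
        where ℓ≤k = toℕ≤pred[n] ℓ

      fixed-count : ∀ {k} (L : Constraints (suc m) k) → Fix (b zero) → VarsIn b (b zero) L →
        (∀ x → 𝟙solves b L x ≢ 0 → iter f k x ≈ b zero) →
        (A : Fin (suc k) → Fin 2) → (∀ j → Satᵢ b (litF (A j) (levelF (toℕ≤pred[n] j) L))) →
        ∑[ x < N ] 𝟙solves b L x
          ≡ ∑[ j < suc k ] (toℕ (A j) * classSize (b zero) ^ freeWords (toℕ j) (truncateAll (toℕ≤pred[n] j) L))
      fixed-count {k} L′ fc vars above A lits = begin
        ∑[ x < N ] 𝟙solves b L′ x
          ≡⟨ sum-cong-≗ {N} split-levels ⟩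
        ∑[ x < N ] ∑[ j < suc k ] (𝟙 ⌊ Cfin-ᵢ? (toℕ j) x ⌋ * 𝟙solves b L′ x)
          ≡⟨ ∑-comm {N} {suc k} (λ x j → 𝟙 ⌊ Cfin-ᵢ? (toℕ j) x ⌋ * 𝟙solves b L′ x) ⟩
        ∑[ j < suc k ] ∑[ x < N ] (𝟙 ⌊ Cfin-ᵢ? (toℕ j) x ⌋ * 𝟙solves b L′ x)
          ≡⟨ sum-cong-≗ {suc k} (λ j → level-count (toℕ≤pred[n] j) L′ fc vars) ⟩
        ∑[ j < suc k ] (𝟙 ⌊ Satᵢ? b (levelF (toℕ≤pred[n] j) L′) ⌋ * c ^ e j)
          ≡⟨ sum-cong-≗ {suc k} (λ j → cong (_* c ^ e j) (litF-𝟙 b (A j) _ (lits j))) ⟩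
        ∑[ j < suc k ] (toℕ (A j) * c ^ e j) ∎
        where
          open ≡-Reasoning
          c = classSize (b zero)
          e : Fin (suc k) → ℕ
          e j = freeWords (toℕ j) (truncateAll (toℕ≤pred[n] j) L′)
          split-levels : ∀ x → 𝟙solves b L′ x ≡ ∑[ j < suc k ] (𝟙 ⌊ Cfin-ᵢ? (toℕ j) x ⌋ * 𝟙solves b L′ x)
          split-levels x with 𝟙solves b L′ x in sol
          ... | zero  = sym (∑-zero {suc k} _ (λ j → *-zeroʳ (𝟙 ⌊ Cfin-ᵢ? (toℕ j) x ⌋)))
          ... | suc n = sym (∑-levels k fix (suc n))
            where
              fix : Fix (iter f k x)
              fix = Fix-resp-≈ (≈-sym (above x λ sol≡0 → 1+n≢0 (trans (sym sol) sol≡0))) fc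

    module _ {k m : ℕ} (s : Fin (suc m) → Vec FG k) (b : Fin (suc m) → X) where
      open Cases s

      solution-above : ∀ x → 𝟙solves b constraints x ≢ 0 → iter f k x ≈ b zero
      solution-above x sol with solution-VarsIn b constraints x sol
      ... | c≈x ∷ _ = ≈-sym c≈x

      inClassF-sound : Satᵢ b inClassF → VarsIn b (b zero) constraints
      inClassF-sound sat = All.universal (λ (_ , t) → Satᵢ-⋀ b (λ t → Eat (var t) y₀) sat t) constraints

      solution-inClass : ∀ x → 𝟙solves b constraints x ≢ 0 → ∀ t → b t ≈ b zero
      solution-inClass x sol t = ≈-trans (All.tabulate⁻ {f = λ t → reverse (s t) , t} vars t) (solution-above x sol)
        where vars = solution-VarsIn b constraints x sol

      case-count : ∀ l → Satᵢ b (caseF l) →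
        ∑[ x < N ] 𝟙solves b constraints x ≡ evalℕ (casePoly l) (classSize (b zero))
      case-count zero (¬fix , ¬init , inClass , consistent) = begin
        ∑[ x < N ] 𝟙solves b constraints x
          ≡⟨ moving-count b k ¬fix (Satᵢ-⋀ b (λ i → ¬F Cinit+ (toℕ i) y₀) ¬init) constraints
                          (inClassF-sound inClass) solution-above consistent ⟩
        classSize (b zero) ^ freeWords k constraints
          ≡⟨ sym (trans (evalℕ-monomial 1 e c) (*-identityˡ (c ^ e))) ⟩
        evalℕ (casePoly zero) (classSize (b zero)) ∎
        where
          open ≡-Reasoning
          c = classSize (b zero)
          e = freeWords k constraints
      case-count (suc l) sat with someLevel? (finToFun l)
      ... | no _ = ⊥-elim sat
      ... | yes _ = let (fix , inClass , lits) = sat in begin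
        ∑[ x < N ] 𝟙solves b constraints x
          ≡⟨ fixed-count b constraints fix (inClassF-sound inClass) solution-above A
                         (Satᵢ-⋀ b (λ j → litF (A j) (levelCaseF j)) lits) ⟩
        ∑[ j < suc k ] (toℕ (A j) * classSize (b zero) ^ levelExponent j)
          ≡⟨ sum-cong-≗ {suc k} (λ j → evalℕ-monomial (toℕ (A j)) (levelExponent j) c) ⟨
        ∑[ j < suc k ] evalℕ (P j) c
          ≡⟨ evalℕ-∑ₚ P c ⟨
        evalℕ (∑ₚ P) c ∎
        where
          open ≡-Reasoning
          A = finToFun l
          c = classSize (b zero)
          P = λ j → monomial (toℕ (A j)) (levelExponent j)

      case-cover : ∀ x → 𝟙solves b constraints x ≢ 0 → Σ (Fin cases) (λ l → Satᵢ b (caseF l))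
      case-cover x sol with Fix? (b zero)
      ... | no ¬fix =
        zero , ¬fix , ⋀-intro b (λ i → ¬F Cinit+ (toℕ i) y₀) (moving⇒¬Cinit k ¬fix (solution-above x sol)) ,
        ⋀-intro b (λ t → Eat (var t) y₀) (solution-inClass x sol) , consistent-sound b k constraints x sol
      ... | yes fix = suc (funToFin A*) , fixed-sat
        where
          A* : Pattern
          A* j = bit (Satᵢ? b (levelCaseF j))
          fixed-sat : Satᵢ b (fixedCaseF (finToFun (funToFin A*)))
          fixed-sat with someLevel? (finToFun (funToFin A*))
          ... | yes _ = fix , ⋀-intro b (λ t → Eat (var t) y₀) (solution-inClass x sol) ,
            ⋀-intro b (λ j → litF (finToFun (funToFin A*) j) (levelCaseF j)) λ j →
              subst (λ β → Satᵢ b (litF β (levelCaseF j))) (sym (finToFun-funToFin A* j))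
                    (litF-bit b (levelCaseF j))
          ... | no none =
            let (ℓ , satℓ) = fixed-level b constraints x fix (solution-above x sol) sol
            in none (ℓ , trans (finToFun-funToFin A* ℓ) (bit-yes (Satᵢ? b (levelCaseF ℓ)) satℓ))

      factor-count : ∀ l → Satᵢ b (caseF l) →
        ℤ.+ cardBasic M s b ≡ evalPoly (toPoly (casePoly l)) (ℤ.+ cardClass M (b zero))
      factor-count l sat = begin
        ℤ.+ cardBasic M s b
          ≡⟨ cong ℤ.+_ (countFin≡∑𝟙 N (λ x → allFinB (suc m) (λ j → ⌊ applyWord f g (s j) x ≟ b j ⌋))) ⟩
        ℤ.+ ∑[ x < N ] 𝟙 (allFinB (suc m) (λ j → ⌊ applyWord f g (s j) x ≟ b j ⌋))
          ≡⟨ cong ℤ.+_ (sum-cong-≗ {N} λ x → 𝟙allFinB≡𝟙solves b (suc m) s (λ j → j) x) ⟩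
        ℤ.+ ∑[ x < N ] 𝟙solves b constraints x
          ≡⟨ cong ℤ.+_ (case-count l sat) ⟩
        ℤ.+ evalℕ (casePoly l) (classSize (b zero))
          ≡⟨ cong (λ c → ℤ.+ evalℕ (casePoly l) c) (countFin≡∑𝟙 N (λ z → E z (b zero))) ⟨
        ℤ.+ evalℕ (casePoly l) (cardClass M (b zero))
          ≡⟨ evalPoly-toPoly (casePoly l) _ ⟨
        evalPoly (toPoly (casePoly l)) (ℤ.+ cardClass M (b zero)) ∎
        where open ≡-Reasoning

      factor-cover : ∀ x → (∀ j → applyWord f g (s j) x ≡ b j) → Σ (Fin cases) (λ l → Satᵢ b (caseF l))
      factor-cover x sol = case-cover x λ ≡0 → 1+n≢0 (trans (sym (solves-tabulate b (suc m) s (λ j → j) x sol)) ≡0)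

-- Transfer to the ultraproduct

module UltraproductFacts {I : Set} (𝒰 : Ultrafilter I) (Ms : I → FinStr) where
  open Ultrafilter 𝒰
  open Ultraproduct 𝒰 Ms
  module Mᵢ (i : I) = Factor (Ms i)
  open Mᵢ using (Satᵢ; Axioms)

  _at_ : ∀ {K} → (Fin K → Car) → (i : I) → Fin K → Mᵢ.X i
  (b at i) j = b j i

  U-disjoint : ∀ {A B : I → Set} → U A → U B → (∀ i → A i → B i → ⊥) → ⊥
  U-disjoint ua ub disjoint = U-proper (U-mono (λ i (a , b) → disjoint i a b) (U-∩ ua ub))

  U-¬ : ∀ {A : I → Set} → ¬ U A → U (λ i → ¬ A i)
  U-¬ {A} ¬ua with U-ultra A
  ... | inj₁ ua  = ⊥-elim (¬ua ua)
  ... | inj₂ u¬a = u¬a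

  U-stable : ∀ {A : I → Set} → ¬ U (λ i → ¬ A i) → U A
  U-stable {A} ¬u¬a with U-ultra A
  ... | inj₁ ua  = ua
  ... | inj₂ u¬a = ⊥-elim (¬u¬a u¬a)

  U-∀Fin : ∀ n {P : Fin n → I → Set} → (∀ j → U (P j)) → U (λ i → ∀ j → P j i)
  U-∀Fin zero    uP = U-mono (λ i _ ()) U-full
  U-∀Fin (suc n) uP = U-mono (λ { i (p₀ , ps) zero → p₀ ; i (p₀ , ps) (suc j) → ps j })
                             (U-∩ (uP zero) (U-∀Fin n (uP ∘ suc)))

  choose : ∀ {n} {P : Fin (suc n) → Set} → Dec (Σ (Fin (suc n)) P) → Fin (suc n)
  choose (yes (x , _)) = x
  choose (no _)        = zero

  choose-spec : ∀ {n} {P : Fin (suc n) → Set} (d : Dec (Σ (Fin (suc n)) P)) → Σ (Fin (suc n)) P → P (choose d)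
  choose-spec (yes (_ , p)) _ = p
  choose-spec (no ¬∃) ∃p = ⊥-elim (¬∃ ∃p)

  iter-at : ∀ n (x : Car) i → iter fₘ n x i ≡ iter (FinStr.f (Ms i)) n (x i)
  iter-at zero    x i = refl
  iter-at (suc n) x i = cong (FinStr.f (Ms i)) (iter-at n x i)

  applyWord-at : ∀ {k} (w : Vec FG k) (x : Car) i →
    applyWord fₘ gₘ w x i ≡ applyWord (FinStr.f (Ms i)) (FinStr.g (Ms i)) w (x i)
  applyWord-at []      x i = refl
  applyWord-at (𝑓 ∷ w) x i = cong (FinStr.f (Ms i)) (applyWord-at w x i)
  applyWord-at (𝑔 ∷ w) x i = cong (FinStr.g (Ms i)) (applyWord-at w x i)

  evalTerm-at : ∀ {K} (b : Fin K → Car) t i → evalTerm b t i ≡ Mᵢ.evalᵢ i (b at i) t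
  evalTerm-at b (var j) i = refl
  evalTerm-at b (fT t)  i = cong (FinStr.f (Ms i)) (evalTerm-at b t i)
  evalTerm-at b (gT t)  i = cong (FinStr.g (Ms i)) (evalTerm-at b t i)

  iter-evalTerm-at : ∀ {K} n (b : Fin K → Car) t i →
    iter fₘ n (evalTerm b t) i ≡ iter (FinStr.f (Ms i)) n (Mᵢ.evalᵢ i (b at i) t)
  iter-evalTerm-at n b t i = trans (iter-at n (evalTerm b t) i) (cong (iter (FinStr.f (Ms i)) n) (evalTerm-at b t i))

  at⇒¬FixF : (x : Car) → U (λ i → ¬ Mᵢ.Fix i (x i)) → ¬ FixF x
  at⇒¬FixF x u¬fix fix = U-disjoint fix u¬fix λ i fx ¬fx → ¬fx fx

  at⇒NoPreF : (x : Car) → U (λ i → Mᵢ.NoPre i (x i)) → NoPreF x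
  at⇒NoPreF x u¬pre (z , fz≡x) = U-disjoint fz≡x u¬pre λ i e ¬pre → ¬pre (z i , e)

  NoPreF⇒at : (x : Car) → NoPreF x → U (λ i → Mᵢ.NoPre i (x i))
  NoPreF⇒at x ¬pre with U-ultra (λ i → Mᵢ.Pre i (x i))
  ... | inj₂ u¬pre = u¬pre
  ... | inj₁ upre  = ⊥-elim (¬pre (z , U-mono (λ i → choose-spec (Mᵢ.Pre? i (x i))) upre))
    where z : Car
          z i = choose (Mᵢ.Pre? i (x i))

  łoś→ : ∀ {K} (b : Fin K → Car) φ → Sat b φ → U (λ i → Satᵢ i (b at i) φ)
  łoś← : ∀ {K} (b : Fin K → Car) φ → U (λ i → Satᵢ i (b at i) φ) → Sat b φ

  łoś→ b ⊤F _ = U-full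
  łoś→ b ⊥F ()
  łoś→ b (t ≐ u) sat = U-mono (λ i e → subst₂ _≡_ (evalTerm-at b t i) (evalTerm-at b u i) e) sat
  łoś→ b (Eat t u) sat =
    U-mono (λ i e → subst₂ (λ p q → FinStr.E (Ms i) p q ≡ true) (evalTerm-at b t i) (evalTerm-at b u i) e) sat
  łoś→ b (Cinit+ k t) (x , ¬pre , e) =
    U-mono (λ i (¬preᵢ , eᵢ) → x i , ¬preᵢ , trans (sym (iter-at k x i)) (trans eᵢ (evalTerm-at b t i)))
           (U-∩ (NoPreF⇒at x ¬pre) e)
  łoś→ b (Cfin- zero t) sat = U-mono (λ i → subst (Mᵢ.Fix i) (evalTerm-at b t i)) sat
  łoś→ b (Cfin- (suc k) t) (fix , ¬fix) =
    U-mono (λ i (fixᵢ , ¬fixᵢ) → subst (Mᵢ.Fix i) (iter-evalTerm-at (suc k) b t i) fixᵢ ,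
                                 ¬fixᵢ ∘ subst (Mᵢ.Fix i) (sym (iter-evalTerm-at k b t i)))
           (U-∩ fix (U-¬ ¬fix))
  łoś→ b (¬F φ) ¬sat = U-¬ (¬sat ∘ łoś← b φ)
  łoś→ b (φ ∧F ψ) (satφ , satψ) = U-∩ (łoś→ b φ satφ) (łoś→ b ψ satψ)
  łoś→ b (φ ∨F ψ) (inj₁ sat) = U-mono (λ i → inj₁) (łoś→ b φ sat)
  łoś→ b (φ ∨F ψ) (inj₂ sat) = U-mono (λ i → inj₂) (łoś→ b ψ sat)

  łoś← b ⊤F _ = tt
  łoś← b ⊥F u = U-proper u
  łoś← b (t ≐ u) sat = U-mono (λ i e → subst₂ _≡_ (sym (evalTerm-at b t i)) (sym (evalTerm-at b u i)) e) sat
  łoś← b (Eat t u) sat =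
    U-mono (λ i e → subst₂ (λ p q → FinStr.E (Ms i) p q ≡ true) (sym (evalTerm-at b t i)) (sym (evalTerm-at b u i)) e) sat
  łoś← b (Cinit+ k t) sat =
    x , at⇒NoPreF x (U-mono (λ i satᵢ → proj₁ (spec i satᵢ)) sat) ,
    U-mono (λ i satᵢ → trans (iter-at k x i) (trans (proj₂ (spec i satᵢ)) (sym (evalTerm-at b t i)))) sat
    where
      x : Car
      x i = choose (Mᵢ.Cinit+ᵢ? i k (Mᵢ.evalᵢ i (b at i) t))
      spec = λ i → choose-spec (Mᵢ.Cinit+ᵢ? i k (Mᵢ.evalᵢ i (b at i) t))
  łoś← b (Cfin- zero t) sat = U-mono (λ i → subst (Mᵢ.Fix i) (sym (evalTerm-at b t i))) sat
  łoś← b (Cfin- (suc k) t) sat =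
    U-mono (λ i (fixᵢ , _) → subst (Mᵢ.Fix i) (sym (iter-evalTerm-at (suc k) b t i)) fixᵢ) sat ,
    λ fix → U-disjoint fix sat λ i fixᵢ (_ , ¬fixᵢ) → ¬fixᵢ (subst (Mᵢ.Fix i) (iter-evalTerm-at k b t i) fixᵢ)
  łoś← b (¬F φ) u¬sat sat = U-disjoint u¬sat (łoś→ b φ sat) λ i ¬satᵢ satᵢ → ¬satᵢ satᵢ
  łoś← b (φ ∧F ψ) sat = łoś← b φ (U-mono (λ i → proj₁) sat) , łoś← b ψ (U-mono (λ i → proj₂) sat)
  łoś← b (φ ∨F ψ) sat with U-ultra (λ i → Satᵢ i (b at i) φ)
  ... | inj₁ satφ  = inj₁ (łoś← b φ satφ)
  ... | inj₂ ¬satφ = inj₂ (łoś← b ψ (U-mono (λ i (satᵢ , ¬satφᵢ) → fromInj₂ (⊥-elim ∘ ¬satφᵢ) satᵢ) (U-∩ sat ¬satφ)))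

  -- Łoś's theorem for ∀x∀y∀z (P → C) with decidable matrices: a counterexample in almost every factor
  -- assembles into a counterexample in the ultraproduct.
  transfer₃ : (P C : ∀ i → Mᵢ.X i → Mᵢ.X i → Mᵢ.X i → Set) →
    (∀ i x y z → Dec (P i x y z)) → (∀ i x y z → Dec (C i x y z)) →
    ((x y z : Car) → U (λ i → P i (x i) (y i) (z i)) → U (λ i → C i (x i) (y i) (z i))) →
    U (λ i → ∀ x y z → P i x y z → C i x y z)
  transfer₃ P C P? C? ultra = U-mono holds (U-¬ ¬u-bad)
    where
      Bad : I → Set
      Bad i = Σ (Mᵢ.X i) λ x → Σ (Mᵢ.X i) λ y → Σ (Mᵢ.X i) λ z → P i x y z × ¬ C i x y z
      Bad? : ∀ i → Dec (Bad i)
      Bad? i = any? λ x → any? λ y → any? λ z → P? i x y z ×-dec ¬? (C? i x y z)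
      holds : ∀ i → ¬ Bad i → ∀ x y z → P i x y z → C i x y z
      holds i ¬bad x y z p = decidable-stable (C? i x y z) λ ¬c → ¬bad (x , y , z , p , ¬c)
      pick : ∀ i → Dec (Bad i) → Mᵢ.X i × Mᵢ.X i × Mᵢ.X i
      pick i (yes (x , y , z , _)) = x , y , z
      pick i (no _)                = zero , zero , zero
      pick-bad : ∀ i (d : Dec (Bad i)) → Bad i →
        P i (proj₁ (pick i d)) (proj₁ (proj₂ (pick i d))) (proj₂ (proj₂ (pick i d)))
        × ¬ C i (proj₁ (pick i d)) (proj₁ (proj₂ (pick i d))) (proj₂ (proj₂ (pick i d)))
      pick-bad i (yes (_ , _ , _ , bad)) _   = bad
      pick-bad i (no ¬bad)              bad = ⊥-elim (¬bad bad)
      ¬u-bad : ¬ U Bad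
      ¬u-bad u-bad = U-disjoint (ultra x y z (U-mono (λ i → proj₁) u-pick)) (U-mono (λ i → proj₂) u-pick)
                                λ i c ¬c → ¬c c
        where
          x y z : Car
          x i = proj₁ (pick i (Bad? i))
          y i = proj₁ (proj₂ (pick i (Bad? i)))
          z i = proj₂ (proj₂ (pick i (Bad? i)))
          u-pick = U-mono (λ i → pick-bad i (Bad? i)) u-bad

  module _ (T : ModelOfT) where
    open ModelOfT T

    private
      cfin = proj₁ ax-c
      Fix⇒E-cfin : ∀ x → FixF x → Eₘ x cfin
      Fix⇒E-cfin x = proj₁ (proj₁ (proj₂ ax-c x))
      E-cfin⇒Fix : ∀ x → Eₘ x cfin → FixF x
      E-cfin⇒Fix x = proj₂ (proj₁ (proj₂ ax-c x))
      E-cfin⇒FixG : ∀ x → Eₘ x cfin → FixG x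
      E-cfin⇒FixG x = proj₂ (proj₂ (proj₂ ax-c x))
      cinit = proj₁ ax-d
      NoPre⇒E-cinit : ∀ x → NoPreF x → Eₘ x cinit
      NoPre⇒E-cinit x = proj₁ (proj₁ (proj₂ ax-d x))
      E-cinit⇒NoPre : ∀ x → Eₘ x cinit → NoPreF x
      E-cinit⇒NoPre x = proj₂ (proj₁ (proj₂ ax-d x))

      ≈? : ∀ i (x y : Mᵢ.X i) → Dec (Mᵢ._≈_ i x y)
      ≈? i x y = FinStr.E (Ms i) x y Bool.≟ true

      ~-refl : ∀ x → x ~ x
      ~-refl x = U-mono (λ i _ → refl) U-full

      left : ∀ {A B : I → Set} → U (λ i → A i × B i) → U A
      left = U-mono (λ i → proj₁)
      right : ∀ {A B : I → Set} → U (λ i → A i × B i) → U B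
      right = U-mono (λ i → proj₂)

      -- Axiom (f), whichever of its two clauses (x ∈ C_fin or not) applies.
      preimage-pair : ∀ x y → Eₘ x y → ¬ NoPreF x →
        Σ Car (λ w → U (λ i → ¬ Mᵢ.Fix i (w i)) × fₘ w ~ x × gₘ w ~ y
                   × (∀ w′ → ¬ FixF w′ → fₘ w′ ~ x → gₘ w′ ~ y → w′ ~ w))
      preimage-pair x y x≈y ¬init with U-ultra (λ i → Mᵢ.Fix i (x i))
      ... | inj₁ fix =
        let (w , ¬fix-w , fw , gw , unique) = ax-f-fin x y x≈y ¬init fix
        in w , U-¬ ¬fix-w , fw , gw , λ w′ ¬fix-w′ → unique w′ ¬fix-w′
      ... | inj₂ ¬fix =
        let (w , _ , fw , gw , unique) = ax-f-notfin x y x≈y ¬init (at⇒¬FixF x ¬fix)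
            ¬fix-w = U-mono (λ i (¬fxᵢ , fwᵢ) fix-wᵢ →
                       ¬fxᵢ (trans (cong (FinStr.f (Ms i)) (trans (sym fwᵢ) fix-wᵢ)) fwᵢ)) (U-∩ ¬fix fw)
        in w , ¬fix-w , fw , gw , λ w′ _ → unique w′ tt

    axioms-almost-everywhere : U (λ i → Axioms i)
    axioms-almost-everywhere =
      U-mono axioms
        (U-∩ u-refl (U-∩ u-sym (U-∩ u-trans (U-∩ u-f≈g (U-∩ u-fix-g (U-∩ u-fix-resp (U-∩ u-fix-≈
          (U-∩ u-pre-resp (U-∩ u-reflects (U-∩ u-onto u-injective))))))))))
      where
        u-refl = transfer₃ (λ i _ _ _ → ⊤) (λ i x _ _ → Mᵢ._≈_ i x x) (λ _ _ _ _ → yes tt) (λ i x _ _ → ≈? i x x)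
          λ x _ _ _ → E-refl x
        u-sym = transfer₃ (λ i x y _ → Mᵢ._≈_ i x y) (λ i x y _ → Mᵢ._≈_ i y x)
          (λ i x y _ → ≈? i x y) (λ i x y _ → ≈? i y x)
          λ x y _ → E-sym x y
        u-trans = transfer₃ (λ i x y z → Mᵢ._≈_ i x y × Mᵢ._≈_ i y z) (λ i x _ z → Mᵢ._≈_ i x z)
          (λ i x y z → ≈? i x y ×-dec ≈? i y z) (λ i x _ z → ≈? i x z)
          λ x y z u → E-trans x y z (left u) (right u)
        u-f≈g = transfer₃ (λ i x y _ → Mᵢ._≈_ i x y) (λ i x y _ → Mᵢ._≈_ i (FinStr.f (Ms i) x) (FinStr.g (Ms i) y))
          (λ i x y _ → ≈? i x y) (λ i x y _ → ≈? i _ _)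
          λ x y _ → ax-b x y
        u-fix-g = transfer₃ (λ i x _ _ → Mᵢ.Fix i x) (λ i x _ _ → FinStr.g (Ms i) x ≡ x)
          (λ i x _ _ → Mᵢ.Fix? i x) (λ i x _ _ → FinStr.g (Ms i) x ≟ x)
          λ x _ _ fix → E-cfin⇒FixG x (Fix⇒E-cfin x fix)
        u-fix-resp = transfer₃ (λ i x y _ → Mᵢ._≈_ i x y × Mᵢ.Fix i x) (λ i _ y _ → Mᵢ.Fix i y)
          (λ i x y _ → ≈? i x y ×-dec Mᵢ.Fix? i x) (λ i _ y _ → Mᵢ.Fix? i y)
          λ x y _ u → E-cfin⇒Fix y (E-trans y x cfin (E-sym x y (left u)) (Fix⇒E-cfin x (right u)))
        u-fix-≈ = transfer₃ (λ i x y _ → Mᵢ.Fix i x × Mᵢ.Fix i y) (λ i x y _ → Mᵢ._≈_ i x y)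
          (λ i x y _ → Mᵢ.Fix? i x ×-dec Mᵢ.Fix? i y) (λ i x y _ → ≈? i x y)
          λ x y _ u → E-trans x cfin y (Fix⇒E-cfin x (left u)) (E-sym y cfin (Fix⇒E-cfin y (right u)))
        u-pre-resp = transfer₃ (λ i x y z → Mᵢ._≈_ i x y × FinStr.f (Ms i) z ≡ x) (λ i _ y _ → Mᵢ.Pre i y)
          (λ i x y z → ≈? i x y ×-dec (FinStr.f (Ms i) z ≟ x)) (λ i _ y _ → Mᵢ.Pre? i y)
          λ x y z u → U-stable λ ¬pre →
            let y-init = NoPre⇒E-cinit y (at⇒NoPreF y ¬pre)
            in E-cinit⇒NoPre x (E-trans x y cinit (left u) y-init) (z , right u)
        u-reflects = transfer₃
          (λ i x y _ → ¬ Mᵢ.Fix i x × ¬ Mᵢ.Fix i y × Mᵢ._≈_ i (FinStr.f (Ms i) x) (FinStr.f (Ms i) y))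
          (λ i x y _ → Mᵢ._≈_ i x y)
          (λ i x y _ → ¬? (Mᵢ.Fix? i x) ×-dec (¬? (Mᵢ.Fix? i y) ×-dec ≈? i _ _)) (λ i x y _ → ≈? i x y)
          λ x y _ u → ax-e x y (at⇒¬FixF x (left u)) (at⇒¬FixF y (left (right u))) (right (right u))
        u-onto = transfer₃ (λ i x y z → Mᵢ._≈_ i x y × FinStr.f (Ms i) z ≡ x)
          (λ i x y _ → Σ (Mᵢ.X i) λ w → ¬ Mᵢ.Fix i w × FinStr.f (Ms i) w ≡ x × FinStr.g (Ms i) w ≡ y)
          (λ i x y z → ≈? i x y ×-dec (FinStr.f (Ms i) z ≟ x))
          (λ i x y _ → any? λ w → ¬? (Mᵢ.Fix? i w) ×-dec ((FinStr.f (Ms i) w ≟ x) ×-dec (FinStr.g (Ms i) w ≟ y)))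
          λ x y z u →
            let (w , ¬fix-w , fw , gw , _) = preimage-pair x y (left u) λ ¬pre → ¬pre (z , right u)
            in U-mono (λ i (a , b , c) → w i , a , b , c) (U-∩ ¬fix-w (U-∩ fw gw))
        u-injective = transfer₃
          (λ i z z′ _ → ¬ Mᵢ.Fix i z × ¬ Mᵢ.Fix i z′
                      × FinStr.f (Ms i) z ≡ FinStr.f (Ms i) z′ × FinStr.g (Ms i) z ≡ FinStr.g (Ms i) z′)
          (λ i z z′ _ → z ≡ z′)
          (λ i z z′ _ → ¬? (Mᵢ.Fix? i z) ×-dec (¬? (Mᵢ.Fix? i z′) ×-dec ((_ ≟ _) ×-dec (_ ≟ _))))
          (λ i z z′ _ → z ≟ z′)
          λ z z′ _ u →
            let (w , _ , _ , _ , unique) =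
                  preimage-pair (fₘ z) (gₘ z) (ax-b z z (E-refl z)) λ ¬pre → ¬pre (z , ~-refl _)
                z~w  = unique z  (at⇒¬FixF z (left u)) (~-refl _) (~-refl _)
                z′~w = unique z′ (at⇒¬FixF z′ (left (right u)))
                         (U-mono (λ i (_ , _ , e , _) → sym e) u) (U-mono (λ i (_ , _ , _ , e) → sym e) u)
            in U-mono (λ i (e , e′) → trans e (sym e′)) (U-∩ z~w z′~w)
        axioms : ∀ i → _ → Axioms i
        axioms i (refl′ , sym′ , trans′ , f≈g′ , fix-g , fix-resp , fix-≈ , pre-resp , reflects , onto , injective) =
          record
            { ≈-refl          = λ x → refl′ x x x tt
            ; ≈-sym           = λ {x} {y} → sym′ x y x
            ; ≈-trans         = λ {x} {y} {z} p q → trans′ x y z (p , q)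
            ; f≈g             = λ {x} {y} → f≈g′ x y x
            ; Fix⇒g-fixed     = λ {x} → fix-g x x x
            ; Fix-resp-≈      = λ {x} {y} p q → fix-resp x y x (p , q)
            ; Fix-≈           = λ {x} {y} p q → fix-≈ x y x (p , q)
            ; Pre-resp-≈      = λ { {x} {y} p (z , fz) → pre-resp x y z (p , fz) }
            ; f-reflects-≈    = λ {x} {y} p q r → reflects x y x (p , q , r)
            ; ⟨f,g⟩-onto      = λ { {x} {y} p (z , fz) → onto x y z (p , fz) }
            ; ⟨f,g⟩-injective = λ {z} {z′} p q r s → injective z z′ z (p , q , r , s)
            }

    qfDefPolyCard-from-factors : ∀ {k m} (s : Fin (suc m) → Vec FG k) r (F : Fin r → Poly) (π : Fin r → QF (suc m)) →
      (∀ l → NonZeroPoly (F l)) →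
      (∀ i → Axioms i → ∀ b l → Satᵢ i b (π l) →
         ℤ.+ cardBasic (Ms i) s b ≡ evalPoly (F l) (ℤ.+ cardClass (Ms i) (b zero))) →
      (∀ i → Axioms i → ∀ b x → (∀ j → applyWord (FinStr.f (Ms i)) (FinStr.g (Ms i)) (s j) x ≡ b j) →
         Σ (Fin r) (λ l → Satᵢ i b (π l))) →
      QFDefPolyCard s
    qfDefPolyCard-from-factors {m = m} s r F π nonzero count cover = r , F , π , nonzero , λ b → counted b , empty b
      where
        counted : ∀ b l → Sat b (π l) → CardEq s b (F l)
        counted b l sat =
          U-mono (λ i (ax , satᵢ) → count i ax (b at i) l satᵢ) (U-∩ axioms-almost-everywhere (łoś→ b (π l) sat))
        empty : ∀ b → (∀ l → ¬ Sat b (π l)) → BasicEmpty s b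
        empty b none (x , sol) =
          U-proper (U-mono (λ i (ax , solᵢ , ¬sats) → let (l , satᵢ) = cover i ax (b at i) (x i) solᵢ in ¬sats l satᵢ)
                           (U-∩ axioms-almost-everywhere (U-∩ (U-∀Fin (suc m) sol-at) (U-∀Fin r λ l → łoś→ b (¬F π l) (none l)))))
          where
            sol-at : ∀ j → U (λ i → applyWord (FinStr.f (Ms i)) (FinStr.g (Ms i)) (s j) (x i) ≡ b j i)
            sol-at j = U-mono (λ i e → trans (sym (applyWord-at (s j) x i)) e) (sol j)

lemma4p9 : {I : Set} (𝒰 : Ultrafilter I) (Ms : I → FinStr)
           → Ultraproduct.ModelOfT 𝒰 Ms
           → (k m : ℕ) (s : Fin (suc m) → Vec FG k)
           → Ultraproduct.QFDefPolyCard 𝒰 Ms {k} {m} s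
lemma4p9 𝒰 Ms T k m s =
  qfDefPolyCard-from-factors T s cases (toPoly ∘ casePoly) caseF (λ l → toPoly-nonzero (casePoly l) (casePoly-nonzero l))
    (λ i ax → Factor.WithAxioms.factor-count (Ms i) ax s)
    (λ i ax → Factor.WithAxioms.factor-cover (Ms i) ax s)
  where
    open Cases s
    open UltraproductFacts 𝒰 Ms
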